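{- Let $a$ be an integer and $p$ an odd prime with $p\nmid a(a^4-1)$. Let $\{u_n\}_{n\geq0}$ be defined by $u_0=0$, $u_1=1$, $u_{n+1}=2u_n-(a^2+1)u_{n-1}$ for $n\geq1$. If $p\equiv1\pmod4$, then $$\frac{u_{p-1}}{p}\equiv\frac{1}{2a^2}\Big(\sum_{k=1}^{\frac{p-1}{4}}\frac{a^{4k}}{k}+(1+a)q_p(1+a)+(1-a)q_p(1-a)+q_p(a^2+1)\Big)$$ $$\equiv\frac{1}{2a}\Big(-4\sum_{k=1}^{\frac{p-1}{4}}\frac{a^{4k-1}}{4k-1}+(1+a)q_p(1+a)-(1-a)q_p(1-a)\Big)-\frac12q_p(a^2+1)\pmod p;$$ if $p\equiv3\pmod4$, then $$\frac{u_{p+1}}{p}\equiv-\frac{a^2+1}{2a^2}\Big(\sum_{k=1}^{\frac{p-3}{4}}\frac{a^{4k}}{k}+(1+a)q_p(1+a)+(1-a)q_p(1-a)+q_p(a^2+1)\Big)$$ $$\equiv\frac{a^2+1}{2a}\Big(4\sum_{k=1}^{\frac{p+1}{4}}\frac{a^{4k-3}}{4k-3}-(1+a)q_p(1+a)+(1-a)q_p(1-a)\Big)+\frac{a^2+1}{2}q_p(a^2+1)\pmod p.$$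
   Context: For an odd prime $p$ and an integer $x$ with $p\nmid x$, $q_p(x)=\frac{x^{p-1}-1}{p}$. Congruences modulo $p$ between rationals with denominators prime to $p$ are understood in the ring of $p$-integral rationals. -}

module Defs where

open import Data.Nat as ℕ using (ℕ; zero; suc; _∸_)
open import Data.Integer as ℤ using (ℤ; +_)
open import Data.Rational using (ℚ; 0ℚ; _+_; _-_; _*_; _÷_; ↥_; ↧ₙ_; ≢-nonZero)
open import Data.Rational.Properties using (_≟_)
open import Data.Product using (_×_)
open import Relation.Nullary using (¬_; yes; no)
import Data.Nat.Divisibility as ℕD
import Data.Integer.Divisibility as ℤD

ℤ→ℚ : ℤ → ℚ
ℤ→ℚ z = z Data.Rational./ 1

ℕ→ℚ : ℕ → ℚ
ℕ→ℚ n = ℤ→ℚ (+ n)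

-- division on ℚ, totalised by x ÷ 0 = 0 (only ever used with nonzero
-- divisors under the theorem's hypotheses)
_÷'_ : ℚ → ℚ → ℚ
x ÷' y with y ≟ 0ℚ
... | yes _ = 0ℚ
... | no y≢0 = _÷_ x y {{≢-nonZero y≢0}}

infixl 7 _÷'_

u : ℤ → ℕ → ℤ
u a zero = + 0
u a (suc zero) = + 1
u a (suc (suc n)) = (+ 2) ℤ.* u a (suc n) ℤ.- (a ℤ.^ 2 ℤ.+ + 1) ℤ.* u a n

q : ℕ → ℤ → ℚ
q p x = ℤ→ℚ (x ℤ.^ (p ∸ 1) ℤ.- + 1) ÷' ℕ→ℚ p

Σ[1…_] : ℕ → (ℕ → ℚ) → ℚ
Σ[1… zero ] f = 0ℚ
Σ[1… suc n ] f = Σ[1… n ] f + f (suc n)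

PIntegral : ℕ → ℚ → Set
PIntegral p x = ¬ (p ℕD.∣ ↧ₙ x)

-- x ≡ y (mod p) in the ring of p-integral rationals:
-- x, y are p-integral and x - y ∈ p·ℤ_(p)
CongMod : ℕ → ℚ → ℚ → Set
CongMod p x y = PIntegral p x × PIntegral p y × ((+ p) ℤD.∣ (↥ (x - y)))

syntax CongMod p x y = x ≡ₚ y [mod p ]
infix 4 CongMod

-- Let p = n + 1. Since 1 ± ai are the roots of x² - 2x + (a² + 1), a·uₖ is the imaginary part
-- of (1 + ai)ᵏ, and (1 + a²)ᵖ = |(1 + ai)ᵖ|². The binomial theorem gives
-- (1 + x)ᵖ = 1 + xᵖ + p·Σ_{0<j<p} (C(p,j)/p) xʲ with C(p,j)/p ≡ (-1)^{j-1}/j (mod p); applied to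
-- x = ±a and to (1 + ai)ᵖ it expresses (1 ± a) q_p(1 ± a), (1 + a²) q_p(1 + a²) and a·u_{p∓1}/p
-- through sums Σ_{0<j<p} (-1)^{j-1} aʲ wⱼ / j with wⱼ ∈ {1, (-1)ʲ, Re iʲ, Im iʲ}. The signed
-- combinations 1 + (-1)ʲ + 2 Re iʲ and 1 - (-1)ʲ ∓ 2 Im iʲ equal 4·[j ≡ r (mod 4)], which produces
-- the sums over k. Multiplied by the unit 2a²(a² + 1) (p ≡ 1) or 2a² (p ≡ 3), the three sides of
-- each case reduce to the same multiple of 2a(ε h + a(q_p(a) - g)) modulo p, where ε = Im iᵖ and
-- g, h are the reduced binomial sums of the real and imaginary parts of (1 + ai)ᵖ.

module Submission where

open import Defs
open import Data.Nat as ℕ using (ℕ; _∸_)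
open import Data.Nat.DivMod as ND using ()
open import Data.Nat.Primality using (Prime)
open import Data.Integer as ℤ using (ℤ; +_)
open import Data.Integer.Divisibility as ℤD using ()
open import Data.Rational using (ℚ; _+_; _-_; _*_; -_)
open import Data.Product using (_×_)
open import Relation.Binary.PropositionalEquality using (_≡_)
open import Relation.Nullary using (¬_)

open import Data.Empty using (⊥-elim)
open import Data.Integer using (-[1+_])
import Data.Integer.Properties as ℤP
import Data.Integer.Tactic.RingSolver as ℤ-Solver
import Data.Nat.Coprimality as Coprimality
import Data.Nat.Divisibility as ℕD
open import Data.Nat.Primality using (euclidsLemma; prime⇒nonTrivial)
import Data.Nat.Properties as ℕP
import Data.Nat.Tactic.RingSolver as ℕ-Solver
open import Data.Nat using (zero; suc; s≤s)
open import Data.Product using (_,_; proj₁; proj₂)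
open import Data.Rational using (0ℚ; 1ℚ; ↥_; ↧_; toℚᵘ; mkℚ; ≢-nonZero)
open import Data.Rational.Properties as ℚP using (_≟_)
import Data.Rational.Unnormalised as ℚᵘ
import Data.Rational.Unnormalised.Properties as ℚᵘP
open import Data.Sum using (_⊎_; [_,_]′)
open import Level using (0ℓ)
open import Relation.Binary.Bundles using (Setoid)
open import Relation.Binary.PropositionalEquality
  using (refl; sym; trans; cong; cong₂; subst; subst₂; module ≡-Reasoning)
import Relation.Binary.Reasoning.Setoid as SetoidReasoning
open import Relation.Binary.Structures using (IsEquivalence)
open import Relation.Nullary using (yes; no; contradiction; dec⇒maybe)
import Tactic.RingSolver as Solver
import Tactic.RingSolver.Core.AlmostCommutativeRing as ACR

ℚ-ring : ACR.AlmostCommutativeRing 0ℓ 0ℓ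
ℚ-ring = ACR.fromCommutativeRing ℚP.+-*-commutativeRing (λ x → dec⇒maybe (0ℚ ≟ x))

inv : ℚ → ℚ
inv y = 1ℚ ÷' y

÷'≡*inv : ∀ x y → x ÷' y ≡ x * inv y
÷'≡*inv x y with y ≟ 0ℚ
... | yes _ = sym (ℚP.*-zeroʳ x)
... | no _  = cong (x *_) (sym (ℚP.*-identityˡ _))

*-invʳ : ∀ y → ¬ y ≡ 0ℚ → y * inv y ≡ 1ℚ
*-invʳ y y≢0 with y ≟ 0ℚ
... | yes y≡0 = contradiction y≡0 y≢0
... | no y≢0  = trans (cong (y *_) (ℚP.*-identityˡ _)) (ℚP.*-inverseʳ y {{≢-nonZero y≢0}})

*-invˡ : ∀ y → ¬ y ≡ 0ℚ → inv y * y ≡ 1ℚ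
*-invˡ y y≢0 = trans (ℚP.*-comm (inv y) y) (*-invʳ y y≢0)

inv-*-cancelˡ : ∀ y x → ¬ y ≡ 0ℚ → inv y * (y * x) ≡ x
inv-*-cancelˡ y x y≢0 = begin
  inv y * (y * x) ≡⟨ ℚP.*-assoc (inv y) y x ⟨
  inv y * y * x   ≡⟨ cong (_* x) (*-invˡ y y≢0) ⟩
  1ℚ * x          ≡⟨ ℚP.*-identityˡ x ⟩
  x               ∎
  where open ≡-Reasoning

*-inv-cancelʳ : ∀ y x → ¬ y ≡ 0ℚ → y * (x * inv y) ≡ x
*-inv-cancelʳ y x y≢0 = begin
  y * (x * inv y) ≡⟨ swap y x (inv y) ⟩
  x * (y * inv y) ≡⟨ cong (x *_) (*-invʳ y y≢0) ⟩
  x * 1ℚ          ≡⟨ ℚP.*-identityʳ x ⟩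
  x               ∎
  where
  open ≡-Reasoning
  swap : ∀ y x i → y * (x * i) ≡ x * (y * i)
  swap = Solver.solve-∀ ℚ-ring

*-inv-*ʳ : ∀ x y → ¬ x ≡ 0ℚ → ¬ x * y ≡ 0ℚ → y * inv (x * y) ≡ inv x
*-inv-*ʳ x y x≢0 xy≢0 = begin
  y * inv (x * y)               ≡⟨ inv-*-cancelˡ x (y * inv (x * y)) x≢0 ⟨
  inv x * (x * (y * inv (x * y))) ≡⟨ cong (inv x *_) (ℚP.*-assoc x y (inv (x * y))) ⟨
  inv x * (x * y * inv (x * y))   ≡⟨ cong (inv x *_) (*-invʳ (x * y) xy≢0) ⟩
  inv x * 1ℚ                      ≡⟨ ℚP.*-identityʳ (inv x) ⟩
  inv x                           ∎
  where open ≡-Reasoning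

ℤ→ℚ-via-ℚᵘ : ∀ m → toℚᵘ (ℤ→ℚ m) ℚᵘ.≃ ℚᵘ.mkℚᵘ m 0
ℤ→ℚ-via-ℚᵘ m = ℚP.toℚᵘ-fromℚᵘ (ℚᵘ.mkℚᵘ m 0)

ℤ→ℚ-+ : ∀ m n → ℤ→ℚ (m ℤ.+ n) ≡ ℤ→ℚ m + ℤ→ℚ n
ℤ→ℚ-+ m n = ℚP.toℚᵘ-injective (ℚᵘP.≃-trans (ℤ→ℚ-via-ℚᵘ (m ℤ.+ n))
  (ℚᵘP.≃-sym (ℚᵘP.≃-trans (ℚP.toℚᵘ-homo-+ (ℤ→ℚ m) (ℤ→ℚ n))
    (ℚᵘP.≃-trans (ℚᵘP.+-cong (ℤ→ℚ-via-ℚᵘ m) (ℤ→ℚ-via-ℚᵘ n)) (ℚᵘ.*≡* (cross m n))))))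
  where
  cross : ∀ m n → (m ℤ.* + 1 ℤ.+ n ℤ.* + 1) ℤ.* + 1 ≡ (m ℤ.+ n) ℤ.* + 1
  cross = ℤ-Solver.solve-∀

ℤ→ℚ-* : ∀ m n → ℤ→ℚ (m ℤ.* n) ≡ ℤ→ℚ m * ℤ→ℚ n
ℤ→ℚ-* m n = ℚP.toℚᵘ-injective (ℚᵘP.≃-trans (ℤ→ℚ-via-ℚᵘ (m ℤ.* n))
  (ℚᵘP.≃-sym (ℚᵘP.≃-trans (ℚP.toℚᵘ-homo-* (ℤ→ℚ m) (ℤ→ℚ n))
    (ℚᵘP.≃-trans (ℚᵘP.*-cong (ℤ→ℚ-via-ℚᵘ m) (ℤ→ℚ-via-ℚᵘ n)) (ℚᵘ.*≡* refl)))))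

ℤ→ℚ-neg : ∀ m → ℤ→ℚ (ℤ.- m) ≡ - ℤ→ℚ m
ℤ→ℚ-neg m = ℚP.toℚᵘ-injective (ℚᵘP.≃-trans (ℤ→ℚ-via-ℚᵘ (ℤ.- m))
  (ℚᵘP.≃-sym (ℚᵘP.≃-trans (ℚP.toℚᵘ-homo‿- (ℤ→ℚ m))
    (ℚᵘP.≃-trans (ℚᵘP.-‿cong (ℤ→ℚ-via-ℚᵘ m)) (ℚᵘ.*≡* refl)))))

ℤ→ℚ-- : ∀ m n → ℤ→ℚ (m ℤ.- n) ≡ ℤ→ℚ m - ℤ→ℚ n
ℤ→ℚ-- m n = trans (ℤ→ℚ-+ m (ℤ.- n)) (cong (λ t → ℤ→ℚ m + t) (ℤ→ℚ-neg n))

ℕ→ℚ-+ : ∀ m n → ℕ→ℚ (m ℕ.+ n) ≡ ℕ→ℚ m + ℕ→ℚ n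
ℕ→ℚ-+ m n = trans (cong ℤ→ℚ (ℤP.pos-+ m n)) (ℤ→ℚ-+ (+ m) (+ n))

ℕ→ℚ-* : ∀ m n → ℕ→ℚ (m ℕ.* n) ≡ ℕ→ℚ m * ℕ→ℚ n
ℕ→ℚ-* m n = trans (cong ℤ→ℚ (ℤP.pos-* m n)) (ℤ→ℚ-* (+ m) (+ n))

infixr 8 _^_

_^_ : ℚ → ℕ → ℚ
x ^ zero  = 1ℚ
x ^ suc n = x * x ^ n

ℤ→ℚ-^ : ∀ m n → ℤ→ℚ (m ℤ.^ n) ≡ ℤ→ℚ m ^ n
ℤ→ℚ-^ m zero    = refl
ℤ→ℚ-^ m (suc n) = trans (ℤ→ℚ-* m (m ℤ.^ n)) (cong (ℤ→ℚ m *_) (ℤ→ℚ-^ m n))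

ℤ→ℚ≡0⇒≡0 : ∀ d → ℤ→ℚ d ≡ 0ℚ → d ≡ + 0
ℤ→ℚ≡0⇒≡0 d eq with ℚᵘP.≃-trans (ℚᵘP.≃-sym (ℤ→ℚ-via-ℚᵘ d))
                      (ℚᵘP.≃-trans (ℚP.toℚᵘ-cong eq) (ℤ→ℚ-via-ℚᵘ (+ 0)))
... | ℚᵘ.*≡* e = trans (sym (ℤP.*-identityʳ d)) e

ℕ→ℚ-suc≢0 : ∀ k → ¬ ℕ→ℚ (suc k) ≡ 0ℚ
ℕ→ℚ-suc≢0 k eq with ℤ→ℚ≡0⇒≡0 (+ suc k) eq
... | ()

cross-multiply : ∀ w d m → w * ℤ→ℚ d ≡ ℤ→ℚ m → ↥ w ℤ.* d ≡ m ℤ.* ↧ w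
cross-multiply w@(mkℚ n k _) d m eq with ℚᵘP.≃-trans
    (ℚᵘP.≃-sym (ℚᵘP.≃-trans (ℚP.toℚᵘ-homo-* w (ℤ→ℚ d)) (ℚᵘP.*-congˡ {toℚᵘ w} (ℤ→ℚ-via-ℚᵘ d))))
    (ℚᵘP.≃-trans (ℚP.toℚᵘ-cong eq) (ℤ→ℚ-via-ℚᵘ m))
... | ℚᵘ.*≡* e = trans (sym (ℤP.*-identityʳ (n ℤ.* d)))
                       (trans e (cong (λ t → m ℤ.* + suc t) (ℕP.*-identityʳ k)))

-- Finite sums and the binomial theorem

Σ-cong : ∀ n {f g : ℕ → ℚ} → (∀ k → f (suc k) ≡ g (suc k)) → Σ[1… n ] f ≡ Σ[1… n ] g
Σ-cong zero    e = refl
Σ-cong (suc n) e = cong₂ _+_ (Σ-cong n e) (e n)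

Σ-distrib-+ : ∀ n (f g : ℕ → ℚ) → Σ[1… n ] (λ j → f j + g j) ≡ Σ[1… n ] f + Σ[1… n ] g
Σ-distrib-+ zero    f g = refl
Σ-distrib-+ (suc n) f g =
  trans (cong (_+ (f (suc n) + g (suc n))) (Σ-distrib-+ n f g))
        (swap (Σ[1… n ] f) (Σ[1… n ] g) (f (suc n)) (g (suc n)))
  where
  swap : ∀ a b c d → a + b + (c + d) ≡ a + c + (b + d)
  swap = Solver.solve-∀ ℚ-ring

Σ-distribˡ-* : ∀ n c (f : ℕ → ℚ) → Σ[1… n ] (λ j → c * f j) ≡ c * Σ[1… n ] f
Σ-distribˡ-* zero    c f = sym (ℚP.*-zeroʳ c)
Σ-distribˡ-* (suc n) c f =
  trans (cong (_+ c * f (suc n)) (Σ-distribˡ-* n c f)) (sym (ℚP.*-distribˡ-+ c _ _))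

Σ-head : ∀ n (f : ℕ → ℚ) → Σ[1… suc n ] f ≡ f 1 + Σ[1… n ] (λ j → f (suc j))
Σ-head zero    f = trans (ℚP.+-identityˡ (f 1)) (sym (ℚP.+-identityʳ (f 1)))
Σ-head (suc n) f = trans (cong (_+ f (suc (suc n))) (Σ-head n f)) (ℚP.+-assoc (f 1) _ _)

Σ-blocks-of-4 : ∀ m (f : ℕ → ℚ) →
  Σ[1… m ℕ.* 4 ] f ≡ Σ[1… m ] (λ k → f (k ℕ.* 4 ∸ 3) + f (k ℕ.* 4 ∸ 2) + f (k ℕ.* 4 ∸ 1) + f (k ℕ.* 4))
Σ-blocks-of-4 zero    f = refl
Σ-blocks-of-4 (suc m) f =
  trans (regroup (Σ[1… m ℕ.* 4 ] f) (f (1 ℕ.+ m ℕ.* 4)) (f (2 ℕ.+ m ℕ.* 4)) (f (3 ℕ.+ m ℕ.* 4)) (f (4 ℕ.+ m ℕ.* 4)))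
        (cong (_+ (f (1 ℕ.+ m ℕ.* 4) + f (2 ℕ.+ m ℕ.* 4) + f (3 ℕ.+ m ℕ.* 4) + f (4 ℕ.+ m ℕ.* 4)))
              (Σ-blocks-of-4 m f))
  where
  regroup : ∀ s a b c d → s + a + b + c + d ≡ s + (a + b + c + d)
  regroup = Solver.solve-∀ ℚ-ring

choose : ℕ → ℕ → ℕ
choose n       zero    = 1
choose zero    (suc k) = 0
choose (suc n) (suc k) = choose n k ℕ.+ choose n (suc k)

choose-> : ∀ n k → choose n (suc n ℕ.+ k) ≡ 0
choose-> zero    k = refl
choose-> (suc n) k = cong₂ ℕ._+_ (choose-> n k)
  (trans (cong (choose n) (sym (ℕP.+-suc (suc n) k))) (choose-> n (suc k)))

choose-1 : ∀ n → choose n 1 ≡ n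
choose-1 zero    = refl
choose-1 (suc n) = cong suc (choose-1 n)

choose-diag : ∀ n → choose n n ≡ 1
choose-diag zero    = refl
choose-diag (suc n) = cong₂ ℕ._+_ (choose-diag n)
  (trans (cong (choose n) (cong suc (sym (ℕP.+-identityʳ n)))) (choose-> n 0))

choose-absorb : ∀ n k → choose (suc n) (suc k) ℕ.* suc k ≡ choose n k ℕ.* suc n
choose-absorb zero    zero    = refl
choose-absorb zero    (suc k) = refl
choose-absorb (suc n) zero    =
  trans (ℕP.*-identityʳ _) (trans (cong (λ t → suc (suc t)) (choose-1 n)) (sym (ℕP.*-identityˡ _)))
choose-absorb (suc n) (suc k) = begin
  (a ℕ.+ b ℕ.+ c) ℕ.* (2 ℕ.+ k)                         ≡⟨ expand a b c k ⟩
  (a ℕ.+ b) ℕ.* suc k ℕ.+ (a ℕ.+ b) ℕ.+ c ℕ.* (2 ℕ.+ k) ≡⟨ cong₂ (λ x y → x ℕ.+ (a ℕ.+ b) ℕ.+ y)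
                                                             (choose-absorb n k) (choose-absorb n (suc k)) ⟩
  a ℕ.* suc n ℕ.+ (a ℕ.+ b) ℕ.+ b ℕ.* suc n             ≡⟨ collect a b n ⟩
  (a ℕ.+ b) ℕ.* (2 ℕ.+ n)                               ∎
  where
  open ≡-Reasoning
  a = choose n k
  b = choose n (suc k)
  c = choose (suc n) (suc (suc k))
  expand : ∀ a b c k → (a ℕ.+ b ℕ.+ c) ℕ.* (2 ℕ.+ k) ≡ (a ℕ.+ b) ℕ.* suc k ℕ.+ (a ℕ.+ b) ℕ.+ c ℕ.* (2 ℕ.+ k)
  expand = ℕ-Solver.solve-∀
  collect : ∀ a b n → a ℕ.* suc n ℕ.+ (a ℕ.+ b) ℕ.+ b ℕ.* suc n ≡ (a ℕ.+ b) ℕ.* (2 ℕ.+ n)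
  collect = ℕ-Solver.solve-∀

chooseℚ : ℕ → ℕ → ℚ
chooseℚ n k = ℕ→ℚ (choose n k)

binomialSum : ℕ → (ℕ → ℚ) → ℚ
binomialSum n w = w 0 + Σ[1… n ] (λ j → chooseℚ n j * w j)

binomialSum-cong : ∀ n {w v : ℕ → ℚ} → (∀ j → w j ≡ v j) → binomialSum n w ≡ binomialSum n v
binomialSum-cong n e = cong₂ _+_ (e 0) (Σ-cong n (λ k → cong (chooseℚ n (suc k) *_) (e (suc k))))

binomialSum-distribˡ-* : ∀ n c (w : ℕ → ℚ) → binomialSum n (λ j → c * w j) ≡ c * binomialSum n w
binomialSum-distribˡ-* n c w =
  trans (cong (_+_ (c * w 0)) (trans (Σ-cong n (λ k → swap (chooseℚ n (suc k)) c (w (suc k))))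
                                  (Σ-distribˡ-* n c _)))
        (sym (ℚP.*-distribˡ-+ c _ _))
  where
  swap : ∀ b c w → b * (c * w) ≡ c * (b * w)
  swap = Solver.solve-∀ ℚ-ring

binomialSum-suc : ∀ n (w : ℕ → ℚ) → binomialSum (suc n) w ≡ binomialSum n w + binomialSum n (λ j → w (suc j))
binomialSum-suc n w = begin
  w 0 + Σ[1… suc n ] (λ j → chooseℚ (suc n) j * w j)
    ≡⟨ cong (_+_ (w 0)) (Σ-head n _) ⟩
  w 0 + (chooseℚ (suc n) 1 * w 1 + Σ[1… n ] (λ j → chooseℚ (suc n) (suc j) * w (suc j)))
    ≡⟨ cong (λ t → w 0 + (t * w 1 + Z)) (ℕ→ℚ-+ 1 (choose n 1)) ⟩
  w 0 + ((1ℚ + chooseℚ n 1) * w 1 + Σ[1… n ] (λ j → chooseℚ (suc n) (suc j) * w (suc j)))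
    ≡⟨ cong (λ t → w 0 + ((1ℚ + chooseℚ n 1) * w 1 + t)) pascal ⟩
  w 0 + ((1ℚ + chooseℚ n 1) * w 1 + (X + Y))
    ≡⟨ regroup (w 0) (w 1) (chooseℚ n 1) X Y ⟩
  (w 0 + (chooseℚ n 1 * w 1 + Y)) + (w 1 + X)
    ≡⟨ cong (λ t → (w 0 + t) + (w 1 + X)) (sym (Σ-head-choose n)) ⟩
  binomialSum n w + binomialSum n (λ j → w (suc j)) ∎
  where
  open ≡-Reasoning
  X = Σ[1… n ] (λ j → chooseℚ n j * w (suc j))
  Y = Σ[1… n ] (λ j → chooseℚ n (suc j) * w (suc j))
  Z = Σ[1… n ] (λ j → chooseℚ (suc n) (suc j) * w (suc j))
  pascal : Z ≡ X + Y
  pascal = trans (Σ-cong n (λ k → trans (cong (_* w (suc (suc k))) (ℕ→ℚ-+ (choose n (suc k)) (choose n (suc (suc k)))))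
                                        (ℚP.*-distribʳ-+ (w (suc (suc k))) (chooseℚ n (suc k)) (chooseℚ n (suc (suc k))))))
                 (Σ-distrib-+ n _ _)
  regroup : ∀ w0 w1 b X Y → w0 + ((1ℚ + b) * w1 + (X + Y)) ≡ (w0 + (b * w1 + Y)) + (w1 + X)
  regroup = Solver.solve-∀ ℚ-ring
  Σ-head-choose : ∀ n → Σ[1… n ] (λ j → chooseℚ n j * w j)
                      ≡ chooseℚ n 1 * w 1 + Σ[1… n ] (λ j → chooseℚ n (suc j) * w (suc j))
  Σ-head-choose zero    = sym (trans (cong (_+ 0ℚ) (ℚP.*-zeroˡ (w 1))) (ℚP.+-identityʳ 0ℚ))
  Σ-head-choose (suc n) = trans (Σ-head n _) (cong (_+_ (chooseℚ (suc n) 1 * w 1)) (sym last-vanishes))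
    where
    S = Σ[1… n ] (λ j → chooseℚ (suc n) (suc j) * w (suc j))
    last-vanishes : S + chooseℚ (suc n) (suc (suc n)) * w (suc (suc n)) ≡ S
    last-vanishes = trans (cong (λ t → S + ℕ→ℚ t * w (suc (suc n)))
                                (trans (cong (choose (suc n)) (cong suc (sym (ℕP.+-identityʳ (suc n)))))
                                       (choose-> (suc n) 0)))
                          (trans (cong (_+_ S) (ℚP.*-zeroˡ (w (suc (suc n))))) (ℚP.+-identityʳ S))

binomial-theorem : ∀ x n → (1ℚ + x) ^ n ≡ binomialSum n (x ^_)
binomial-theorem x zero    = sym (ℚP.+-identityʳ 1ℚ)
binomial-theorem x (suc n) = begin
  (1ℚ + x) * (1ℚ + x) ^ n                         ≡⟨ cong ((1ℚ + x) *_) (binomial-theorem x n) ⟩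
  (1ℚ + x) * binomialSum n (x ^_)                  ≡⟨ expand (binomialSum n (x ^_)) x ⟩
  binomialSum n (x ^_) + x * binomialSum n (x ^_)
    ≡⟨ cong (_+_ (binomialSum n (x ^_))) (sym (binomialSum-distribˡ-* n x (x ^_))) ⟩
  binomialSum n (x ^_) + binomialSum n (λ j → x ^ suc j) ≡⟨ sym (binomialSum-suc n (x ^_)) ⟩
  binomialSum (suc n) (x ^_)                       ∎
  where
  open ≡-Reasoning
  expand : ∀ B x → (1ℚ + x) * B ≡ B + x * B
  expand = Solver.solve-∀ ℚ-ring

-- Powers of i and of 1 + ai

sign : ℕ → ℚ
sign zero          = 1ℚ
sign (suc zero)    = - 1ℚ
sign (suc (suc j)) = sign j

sign-suc : ∀ j → sign (suc j) ≡ - sign j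
sign-suc zero          = refl
sign-suc (suc zero)    = refl
sign-suc (suc (suc j)) = sign-suc j

neg-^ : ∀ x j → (- x) ^ j ≡ sign j * x ^ j
neg-^ x zero    = sym (ℚP.*-identityˡ 1ℚ)
neg-^ x (suc j) = begin
  - x * (- x) ^ j        ≡⟨ cong (- x *_) (neg-^ x j) ⟩
  - x * (sign j * x ^ j) ≡⟨ swap x (sign j) (x ^ j) ⟩
  - sign j * (x * x ^ j) ≡⟨ cong (_* (x * x ^ j)) (sym (sign-suc j)) ⟩
  sign (suc j) * x ^ suc j ∎
  where
  open ≡-Reasoning
  swap : ∀ x s w → - x * (s * w) ≡ - s * (x * w)
  swap = Solver.solve-∀ ℚ-ring

-- iʲ = re-i^ j + i · im-i^ j
re-i^ im-i^ : ℕ → ℚ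
re-i^ 0 = 1ℚ
re-i^ 1 = 0ℚ
re-i^ 2 = - 1ℚ
re-i^ 3 = 0ℚ
re-i^ (suc (suc (suc (suc j)))) = re-i^ j
im-i^ 0 = 0ℚ
im-i^ 1 = 1ℚ
im-i^ 2 = 0ℚ
im-i^ 3 = - 1ℚ
im-i^ (suc (suc (suc (suc j)))) = im-i^ j

re-i^-suc : ∀ j → re-i^ (suc j) ≡ - im-i^ j
re-i^-suc 0 = refl
re-i^-suc 1 = refl
re-i^-suc 2 = refl
re-i^-suc 3 = refl
re-i^-suc (suc (suc (suc (suc j)))) = re-i^-suc j

im-i^-suc : ∀ j → im-i^ (suc j) ≡ re-i^ j
im-i^-suc 0 = refl
im-i^-suc 1 = refl
im-i^-suc 2 = refl
im-i^-suc 3 = refl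
im-i^-suc (suc (suc (suc (suc j)))) = im-i^-suc j

-- (1 + x i)ⁿ = gaussRe x n + i · gaussIm x n
gaussRe gaussIm : ℚ → ℕ → ℚ
gaussRe x zero    = 1ℚ
gaussRe x (suc n) = gaussRe x n - x * gaussIm x n
gaussIm x zero    = 0ℚ
gaussIm x (suc n) = gaussIm x n + x * gaussRe x n

gauss-binomial : ∀ x n → gaussRe x n ≡ binomialSum n (λ j → x ^ j * re-i^ j)
                       × gaussIm x n ≡ binomialSum n (λ j → x ^ j * im-i^ j)
gauss-binomial x zero    = sym (ℚP.+-identityʳ _) , sym (ℚP.+-identityʳ _)
gauss-binomial x (suc n) = re-step , im-step
  where
  open ≡-Reasoning
  wRe wIm : ℕ → ℚ
  wRe j = x ^ j * re-i^ j
  wIm j = x ^ j * im-i^ j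
  IH = gauss-binomial x n
  re-step : gaussRe x n - x * gaussIm x n ≡ binomialSum (suc n) wRe
  re-step = begin
    gaussRe x n - x * gaussIm x n               ≡⟨ cong₂ (λ s t → s - x * t) (proj₁ IH) (proj₂ IH) ⟩
    binomialSum n wRe - x * binomialSum n wIm   ≡⟨ cong (_+_ (binomialSum n wRe)) (ℚP.neg-distribˡ-* x (binomialSum n wIm)) ⟩
    binomialSum n wRe + (- x) * binomialSum n wIm ≡⟨ cong (_+_ (binomialSum n wRe)) (sym (binomialSum-distribˡ-* n (- x) wIm)) ⟩
    binomialSum n wRe + binomialSum n (λ j → (- x) * wIm j)
      ≡⟨ cong (_+_ (binomialSum n wRe)) (binomialSum-cong n λ j →
           trans (rotate x (x ^ j) (im-i^ j)) (cong (x * x ^ j *_) (sym (re-i^-suc j)))) ⟩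
    binomialSum n wRe + binomialSum n (λ j → wRe (suc j)) ≡⟨ sym (binomialSum-suc n wRe) ⟩
    binomialSum (suc n) wRe ∎
    where
    rotate : ∀ x w i → (- x) * (w * i) ≡ x * w * (- i)
    rotate = Solver.solve-∀ ℚ-ring
  im-step : gaussIm x n + x * gaussRe x n ≡ binomialSum (suc n) wIm
  im-step = begin
    gaussIm x n + x * gaussRe x n               ≡⟨ cong₂ (λ s t → s + x * t) (proj₂ IH) (proj₁ IH) ⟩
    binomialSum n wIm + x * binomialSum n wRe   ≡⟨ cong (_+_ (binomialSum n wIm)) (sym (binomialSum-distribˡ-* n x wRe)) ⟩
    binomialSum n wIm + binomialSum n (λ j → x * wRe j)
      ≡⟨ cong (_+_ (binomialSum n wIm)) (binomialSum-cong n λ j →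
           trans (sym (ℚP.*-assoc x (x ^ j) (re-i^ j))) (cong (x * x ^ j *_) (sym (im-i^-suc j)))) ⟩
    binomialSum n wIm + binomialSum n (λ j → wIm (suc j)) ≡⟨ sym (binomialSum-suc n wIm) ⟩
    binomialSum (suc n) wIm ∎

gauss-norm : ∀ x n → gaussRe x n * gaussRe x n + gaussIm x n * gaussIm x n ≡ (1ℚ + x * x) ^ n
gauss-norm x zero    = refl
gauss-norm x (suc n) =
  trans (multiplicative x (gaussRe x n) (gaussIm x n)) (cong ((1ℚ + x * x) *_) (gauss-norm x n))
  where
  multiplicative : ∀ x s t → (s - x * t) * (s - x * t) + (t + x * s) * (t + x * s)
                             ≡ (1ℚ + x * x) * (s * s + t * t)
  multiplicative = Solver.solve-∀ ℚ-ring

gaussIm-norm : ∀ x n → (1ℚ + x * x) * gaussIm x n ≡ gaussIm x (suc n) - x * gaussRe x (suc n)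
gaussIm-norm x n = expand x (gaussRe x n) (gaussIm x n)
  where
  expand : ∀ x s t → (1ℚ + x * x) * t ≡ (t + x * s) - x * (s - x * t)
  expand = Solver.solve-∀ ℚ-ring

ℤ→ℚ-a²+1 : ∀ a → ℤ→ℚ (a ℤ.^ 2 ℤ.+ + 1) ≡ 1ℚ + ℤ→ℚ a * ℤ→ℚ a
ℤ→ℚ-a²+1 a = trans (ℤ→ℚ-+ (a ℤ.^ 2) (+ 1))
  (trans (cong (_+ 1ℚ) (trans (ℤ→ℚ-^ a 2) (cong (ℤ→ℚ a *_) (ℚP.*-identityʳ (ℤ→ℚ a)))))
         (ℚP.+-comm (ℤ→ℚ a * ℤ→ℚ a) 1ℚ))

-- u is the Lucas sequence of the roots 1 ± ai, so a·uₙ = Im (1 + ai)ⁿ.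
a*u≡gaussIm : ∀ a n → ℤ→ℚ a * ℤ→ℚ (u a n) ≡ gaussIm (ℤ→ℚ a) n
                    × ℤ→ℚ a * ℤ→ℚ (u a (suc n)) ≡ gaussIm (ℤ→ℚ a) (suc n)
a*u≡gaussIm a zero    = ℚP.*-zeroʳ (ℤ→ℚ a) , sym (ℚP.+-identityˡ (ℤ→ℚ a * 1ℚ))
a*u≡gaussIm a (suc n) = proj₂ IH , step
  where
  open ≡-Reasoning
  A  = ℤ→ℚ a
  u₀ = ℤ→ℚ (u a n)
  u₁ = ℤ→ℚ (u a (suc n))
  IH = a*u≡gaussIm a n
  recurrence : ℤ→ℚ (u a (suc (suc n))) ≡ (1ℚ + 1ℚ) * u₁ - (1ℚ + A * A) * u₀
  recurrence = trans (ℤ→ℚ-- ((+ 2) ℤ.* u a (suc n)) ((a ℤ.^ 2 ℤ.+ + 1) ℤ.* u a n))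
    (cong₂ _-_ (ℤ→ℚ-* (+ 2) (u a (suc n)))
               (trans (ℤ→ℚ-* (a ℤ.^ 2 ℤ.+ + 1) (u a n)) (cong (_* u₀) (ℤ→ℚ-a²+1 a))))
  step : A * ℤ→ℚ (u a (suc (suc n))) ≡ gaussIm A (suc (suc n))
  step = begin
    A * ℤ→ℚ (u a (suc (suc n)))                               ≡⟨ cong (A *_) recurrence ⟩
    A * ((1ℚ + 1ℚ) * u₁ - (1ℚ + A * A) * u₀)                  ≡⟨ distrib A u₁ u₀ ⟩
    (1ℚ + 1ℚ) * (A * u₁) - (1ℚ + A * A) * (A * u₀)            ≡⟨ cong₂ (λ s t → (1ℚ + 1ℚ) * s - (1ℚ + A * A) * t)
                                                                       (proj₂ IH) (proj₁ IH) ⟩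
    (1ℚ + 1ℚ) * gaussIm A (suc n) - (1ℚ + A * A) * gaussIm A n ≡⟨ unfold A (gaussRe A n) (gaussIm A n) ⟩
    gaussIm A (suc (suc n))                                    ∎
    where
    distrib : ∀ A s t → A * ((1ℚ + 1ℚ) * s - (1ℚ + A * A) * t) ≡ (1ℚ + 1ℚ) * (A * s) - (1ℚ + A * A) * (A * t)
    distrib = Solver.solve-∀ ℚ-ring
    unfold : ∀ A s t → (1ℚ + 1ℚ) * (t + A * s) - (1ℚ + A * A) * t ≡ (t + A * s) + A * (s - A * t)
    unfold = Solver.solve-∀ ℚ-ring

-- Residues modulo 4 in the logarithmic series

periodic₄ : ∀ {A : Set} (τ : ℕ → A) → (∀ j → τ (4 ℕ.+ j) ≡ τ j) → ∀ r k → τ (r ℕ.+ k ℕ.* 4) ≡ τ r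
periodic₄ τ τ-periodic r zero    = cong τ (ℕP.+-identityʳ r)
periodic₄ τ τ-periodic r (suc k) =
  trans (cong τ (shift r (k ℕ.* 4))) (trans (τ-periodic (r ℕ.+ k ℕ.* 4)) (periodic₄ τ τ-periodic r k))
  where
  shift : ∀ r x → r ℕ.+ (4 ℕ.+ x) ≡ 4 ℕ.+ (r ℕ.+ x)
  shift = ℕ-Solver.solve-∀

sign-periodic : ∀ r k → sign (r ℕ.+ k ℕ.* 4) ≡ sign r
sign-periodic = periodic₄ sign (λ _ → refl)

re-i^-periodic : ∀ r k → re-i^ (r ℕ.+ k ℕ.* 4) ≡ re-i^ r
re-i^-periodic = periodic₄ re-i^ (λ _ → refl)

im-i^-periodic : ∀ r k → im-i^ (r ℕ.+ k ℕ.* 4) ≡ im-i^ r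
im-i^-periodic = periodic₄ im-i^ (λ _ → refl)

δ₀ δ₁ δ₃ : ℕ → ℚ
δ₀ 0 = ℕ→ℚ 4
δ₀ 1 = 0ℚ
δ₀ 2 = 0ℚ
δ₀ 3 = 0ℚ
δ₀ (suc (suc (suc (suc j)))) = δ₀ j
δ₁ 0 = 0ℚ
δ₁ 1 = ℕ→ℚ 4
δ₁ 2 = 0ℚ
δ₁ 3 = 0ℚ
δ₁ (suc (suc (suc (suc j)))) = δ₁ j
δ₃ 0 = 0ℚ
δ₃ 1 = 0ℚ
δ₃ 2 = 0ℚ
δ₃ 3 = ℕ→ℚ 4
δ₃ (suc (suc (suc (suc j)))) = δ₃ j

δ₀-via-i^ : ∀ j → 1ℚ + 1ℚ * sign j + (1ℚ + 1ℚ) * re-i^ j ≡ δ₀ j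
δ₀-via-i^ 0 = refl
δ₀-via-i^ 1 = refl
δ₀-via-i^ 2 = refl
δ₀-via-i^ 3 = refl
δ₀-via-i^ (suc (suc (suc (suc j)))) = δ₀-via-i^ j

δ₃-via-i^ : ∀ j → 1ℚ + - 1ℚ * sign j + - ((1ℚ + 1ℚ) * 1ℚ) * im-i^ j ≡ δ₃ j
δ₃-via-i^ 0 = refl
δ₃-via-i^ 1 = refl
δ₃-via-i^ 2 = refl
δ₃-via-i^ 3 = refl
δ₃-via-i^ (suc (suc (suc (suc j)))) = δ₃-via-i^ j

δ₁-via-i^ : ∀ j → 1ℚ + - 1ℚ * sign j + - ((1ℚ + 1ℚ) * - 1ℚ) * im-i^ j ≡ δ₁ j
δ₁-via-i^ 0 = refl
δ₁-via-i^ 1 = refl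
δ₁-via-i^ 2 = refl
δ₁-via-i^ 3 = refl
δ₁-via-i^ (suc (suc (suc (suc j)))) = δ₁-via-i^ j

powOver : ℚ → ℕ → ℚ
powOver x j = x ^ j * inv (ℕ→ℚ j)

-- the j-th term of log (1 + x) = Σ (-1)^{j-1} xʲ / j, weighted by τ j
logTerm : ℚ → (ℕ → ℚ) → ℕ → ℚ
logTerm x τ j = sign (ℕ.pred j) * inv (ℕ→ℚ j) * (x ^ j * τ j)

logTerm-periodic : ∀ x τ → (∀ j → τ (4 ℕ.+ j) ≡ τ j) → ∀ r k →
                logTerm x τ (suc r ℕ.+ k ℕ.* 4) ≡ sign r * τ (suc r) * powOver x (suc r ℕ.+ k ℕ.* 4)
logTerm-periodic x τ τ-periodic r k =
  trans (cong₂ (λ s t → s * inv (ℕ→ℚ j) * (x ^ j * t)) (sign-periodic r k) (periodic₄ τ τ-periodic (suc r) k))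
        (swap (sign r) (inv (ℕ→ℚ j)) (x ^ j) (τ (suc r)))
  where
  j = suc r ℕ.+ k ℕ.* 4
  swap : ∀ s i y t → s * i * (y * t) ≡ s * t * (y * i)
  swap = Solver.solve-∀ ℚ-ring

Σ-logTerm-blocks : ∀ x τ → (∀ j → τ (4 ℕ.+ j) ≡ τ j) → ∀ m →
  Σ[1… m ℕ.* 4 ] (logTerm x τ)
  ≡ Σ[1… m ] (λ k → τ 1 * powOver x (k ℕ.* 4 ∸ 3) - τ 2 * powOver x (k ℕ.* 4 ∸ 2)
                   + τ 3 * powOver x (k ℕ.* 4 ∸ 1) - τ 4 * powOver x (k ℕ.* 4))
Σ-logTerm-blocks x τ τ-periodic m = trans (Σ-blocks-of-4 m (logTerm x τ)) (Σ-cong m block)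
  where
  block : ∀ k → logTerm x τ (1 ℕ.+ k ℕ.* 4) + logTerm x τ (2 ℕ.+ k ℕ.* 4) + logTerm x τ (3 ℕ.+ k ℕ.* 4)
                 + logTerm x τ (4 ℕ.+ k ℕ.* 4)
               ≡ τ 1 * powOver x (1 ℕ.+ k ℕ.* 4) - τ 2 * powOver x (2 ℕ.+ k ℕ.* 4)
                 + τ 3 * powOver x (3 ℕ.+ k ℕ.* 4) - τ 4 * powOver x (4 ℕ.+ k ℕ.* 4)
  block k = trans (cong₄ (logTerm-periodic x τ τ-periodic 0 k) (logTerm-periodic x τ τ-periodic 1 k)
                         (logTerm-periodic x τ τ-periodic 2 k) (logTerm-periodic x τ τ-periodic 3 k))
                  (signs (τ 1) (τ 2) (τ 3) (τ 4) (powOver x (1 ℕ.+ k ℕ.* 4)) (powOver x (2 ℕ.+ k ℕ.* 4))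
                         (powOver x (3 ℕ.+ k ℕ.* 4)) (powOver x (4 ℕ.+ k ℕ.* 4)))
    where
    cong₄ : ∀ {a b c d a′ b′ c′ d′ : ℚ} → a ≡ a′ → b ≡ b′ → c ≡ c′ → d ≡ d′ →
            a + b + c + d ≡ a′ + b′ + c′ + d′
    cong₄ refl refl refl refl = refl
    signs : ∀ t₁ t₂ t₃ t₄ y₁ y₂ y₃ y₄ →
      1ℚ * t₁ * y₁ + - 1ℚ * t₂ * y₂ + 1ℚ * t₃ * y₃ + - 1ℚ * t₄ * y₄ ≡ t₁ * y₁ - t₂ * y₂ + t₃ * y₃ - t₄ * y₄
    signs = Solver.solve-∀ ℚ-ring

four*inv[k*4] : ∀ k → ℕ→ℚ 4 * inv (ℕ→ℚ (suc k ℕ.* 4)) ≡ inv (ℕ→ℚ (suc k))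
four*inv[k*4] k = trans (cong (λ t → ℕ→ℚ 4 * inv t) (ℕ→ℚ-* (suc k) 4))
  (*-inv-*ʳ (ℕ→ℚ (suc k)) (ℕ→ℚ 4) (ℕ→ℚ-suc≢0 k)
    (subst (λ t → ¬ t ≡ 0ℚ) (ℕ→ℚ-* (suc k) 4) (ℕ→ℚ-suc≢0 (3 ℕ.+ k ℕ.* 4))))

Σ-logTerm-δ₀ : ∀ x m →
  Σ[1… m ℕ.* 4 ] (logTerm x δ₀)
  ≡ - Σ[1… m ] (λ k → x ^ (k ℕ.* 4) * inv (ℕ→ℚ k))
Σ-logTerm-δ₀ x m = begin
  Σ[1… m ℕ.* 4 ] (logTerm x δ₀) ≡⟨ Σ-logTerm-blocks x δ₀ (λ _ → refl) m ⟩
  Σ[1… m ] (λ k → 0ℚ * powOver x (k ℕ.* 4 ∸ 3) - 0ℚ * powOver x (k ℕ.* 4 ∸ 2)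
                 + 0ℚ * powOver x (k ℕ.* 4 ∸ 1) - ℕ→ℚ 4 * powOver x (k ℕ.* 4))
    ≡⟨ Σ-cong m (λ k → trans (only-last (powOver x (suc k ℕ.* 4 ∸ 3)) (powOver x (suc k ℕ.* 4 ∸ 2))
                                         (powOver x (suc k ℕ.* 4 ∸ 1)) (x ^ (suc k ℕ.* 4))
                                         (ℕ→ℚ 4) (inv (ℕ→ℚ (suc k ℕ.* 4))))
                             (cong (λ t → - 1ℚ * (x ^ (suc k ℕ.* 4) * t)) (four*inv[k*4] k))) ⟩
  Σ[1… m ] (λ k → - 1ℚ * S k) ≡⟨ Σ-distribˡ-* m (- 1ℚ) S ⟩
  - 1ℚ * Σ[1… m ] S           ≡⟨ -1*x≡-x (Σ[1… m ] S) ⟩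
  - Σ[1… m ] S                ∎
  where
  open ≡-Reasoning
  S : ℕ → ℚ
  S k = x ^ (k ℕ.* 4) * inv (ℕ→ℚ k)
  only-last : ∀ y₁ y₂ y₃ y F i → 0ℚ * y₁ - 0ℚ * y₂ + 0ℚ * y₃ - F * (y * i) ≡ - 1ℚ * (y * (F * i))
  only-last = Solver.solve-∀ ℚ-ring
  -1*x≡-x : ∀ x → - 1ℚ * x ≡ - x
  -1*x≡-x = Solver.solve-∀ ℚ-ring

Σ-logTerm-δ₀-+2 : ∀ x m →
  Σ[1… 2 ℕ.+ m ℕ.* 4 ] (logTerm x δ₀)
  ≡ - Σ[1… m ] (λ k → x ^ (k ℕ.* 4) * inv (ℕ→ℚ k))
Σ-logTerm-δ₀-+2 x m = trans (cong₂ (λ s t → Σ[1… m ℕ.* 4 ] (logTerm x δ₀) + s + t)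
                                (logTerm-periodic x δ₀ (λ _ → refl) 0 m) (logTerm-periodic x δ₀ (λ _ → refl) 1 m))
                         (trans (zeros (Σ[1… m ℕ.* 4 ] (logTerm x δ₀))
                                       (powOver x (1 ℕ.+ m ℕ.* 4)) (powOver x (2 ℕ.+ m ℕ.* 4)))
                                (Σ-logTerm-δ₀ x m))
  where
  zeros : ∀ s y₁ y₂ → s + 1ℚ * 0ℚ * y₁ + - 1ℚ * 0ℚ * y₂ ≡ s
  zeros = Solver.solve-∀ ℚ-ring

Σ-logTerm-δ₃ : ∀ x m →
  Σ[1… m ℕ.* 4 ] (logTerm x δ₃)
  ≡ ℕ→ℚ 4 * Σ[1… m ] (λ k → powOver x (k ℕ.* 4 ∸ 1))
Σ-logTerm-δ₃ x m = trans (Σ-logTerm-blocks x δ₃ (λ _ → refl) m)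
  (trans (Σ-cong m (λ k → only-third (powOver x (suc k ℕ.* 4 ∸ 3)) (powOver x (suc k ℕ.* 4 ∸ 2))
                                      (powOver x (suc k ℕ.* 4 ∸ 1)) (powOver x (suc k ℕ.* 4)) (ℕ→ℚ 4)))
         (Σ-distribˡ-* m (ℕ→ℚ 4) (λ k → powOver x (k ℕ.* 4 ∸ 1))))
  where
  only-third : ∀ y₁ y₂ y₃ y₄ F → 0ℚ * y₁ - 0ℚ * y₂ + F * y₃ - 0ℚ * y₄ ≡ F * y₃
  only-third = Solver.solve-∀ ℚ-ring

Σ-logTerm-δ₁-+2 : ∀ x m →
  Σ[1… 2 ℕ.+ m ℕ.* 4 ] (logTerm x δ₁)
  ≡ ℕ→ℚ 4 * Σ[1… suc m ] (λ k → powOver x (k ℕ.* 4 ∸ 3))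
Σ-logTerm-δ₁-+2 x m = begin
  Σ[1… m ℕ.* 4 ] (logTerm x δ₁) + logTerm x δ₁ (1 ℕ.+ m ℕ.* 4) + logTerm x δ₁ (2 ℕ.+ m ℕ.* 4)
    ≡⟨ cong₂ (λ s t → Σ[1… m ℕ.* 4 ] (logTerm x δ₁) + s + t)
             (logTerm-periodic x δ₁ (λ _ → refl) 0 m) (logTerm-periodic x δ₁ (λ _ → refl) 1 m) ⟩
  Σ[1… m ℕ.* 4 ] (logTerm x δ₁) + 1ℚ * F * y + - 1ℚ * 0ℚ * powOver x (2 ℕ.+ m ℕ.* 4)
    ≡⟨ cong (λ s → s + 1ℚ * F * y + - 1ℚ * 0ℚ * powOver x (2 ℕ.+ m ℕ.* 4)) blocks ⟩
  F * Σ[1… m ] S + 1ℚ * F * y + - 1ℚ * 0ℚ * powOver x (2 ℕ.+ m ℕ.* 4)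
    ≡⟨ collect F (Σ[1… m ] S) y (powOver x (2 ℕ.+ m ℕ.* 4)) ⟩
  F * Σ[1… suc m ] S ∎
  where
  open ≡-Reasoning
  F = ℕ→ℚ 4
  S : ℕ → ℚ
  S k = powOver x (k ℕ.* 4 ∸ 3)
  y = S (suc m)
  blocks : Σ[1… m ℕ.* 4 ] (logTerm x δ₁) ≡ F * Σ[1… m ] S
  blocks = trans (Σ-logTerm-blocks x δ₁ (λ _ → refl) m)
    (trans (Σ-cong m (λ k → only-first (powOver x (suc k ℕ.* 4 ∸ 3)) (powOver x (suc k ℕ.* 4 ∸ 2))
                                        (powOver x (suc k ℕ.* 4 ∸ 1)) (powOver x (suc k ℕ.* 4)) F))
           (Σ-distribˡ-* m F S))
    where
    only-first : ∀ y₁ y₂ y₃ y₄ F → F * y₁ - 0ℚ * y₂ + 0ℚ * y₃ - 0ℚ * y₄ ≡ F * y₁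
    only-first = Solver.solve-∀ ℚ-ring
  collect : ∀ F s y z → F * s + 1ℚ * F * y + - 1ℚ * 0ℚ * z ≡ F * (s + y)
  collect = Solver.solve-∀ ℚ-ring

prime≢1 : ∀ {p} → Prime p → ¬ p ≡ 1
prime≢1 p-prime refl = ℕP.<-irrefl refl (ℕ.nonTrivial⇒n>1 1 {{prime⇒nonTrivial p-prime}})

module Congruence (p : ℕ) (p-prime : Prime p) where

  P : ℚ
  P = ℕ→ℚ p

  record Unit (d : ℤ) : Set where
    constructor unit
    field p∤d : ¬ p ℕD.∣ ℤ.∣ d ∣
  open Unit

  euclid : ∀ m n → p ℕD.∣ ℤ.∣ m ℤ.* n ∣ → p ℕD.∣ ℤ.∣ m ∣ ⊎ p ℕD.∣ ℤ.∣ n ∣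
  euclid m n p∣mn = euclidsLemma ℤ.∣ m ∣ ℤ.∣ n ∣ p-prime (subst (p ℕD.∣_) (ℤP.abs-* m n) p∣mn)

  unit-* : ∀ {d e} → Unit d → Unit e → Unit (d ℤ.* e)
  unit-* {d} {e} d-unit e-unit = unit λ p∣de → [ p∤d d-unit , p∤d e-unit ]′ (euclid d e p∣de)

  unit-1 : Unit (+ 1)
  unit-1 = unit λ p∣1 → prime≢1 p-prime (ℕD.∣1⇒≡1 p∣1)

  ∣unit-*⇒∣ : ∀ m {d} → Unit d → p ℕD.∣ ℤ.∣ m ℤ.* d ∣ → p ℕD.∣ ℤ.∣ m ∣
  ∣unit-*⇒∣ m {d} d-unit p∣md = [ (λ p∣m → p∣m) , (λ p∣d → ⊥-elim (p∤d d-unit p∣d)) ]′ (euclid m d p∣md)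

  unit⇒≢0 : ∀ {d} → Unit d → ¬ ℤ→ℚ d ≡ 0ℚ
  unit⇒≢0 {d} d-unit eq with ℤ→ℚ≡0⇒≡0 d eq
  ... | refl = p∤d d-unit (p ℕD.∣0)

  record Integral (x : ℚ) : Set where
    constructor integral
    field
      num den  : ℤ
      den-unit : Unit den
      clears   : x * ℤ→ℚ den ≡ ℤ→ℚ num

  integral-ℤ : ∀ m → Integral (ℤ→ℚ m)
  integral-ℤ m = integral m (+ 1) unit-1 (ℚP.*-identityʳ (ℤ→ℚ m))

  integral-0 : Integral 0ℚ
  integral-0 = integral-ℤ (+ 0)

  integral-+ : ∀ {x y} → Integral x → Integral y → Integral (x + y)
  integral-+ {x} {y} (integral m d d-unit x-clears) (integral n e e-unit y-clears) =
    integral (m ℤ.* e ℤ.+ n ℤ.* d) (d ℤ.* e) (unit-* d-unit e-unit) (begin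
      (x + y) * ℤ→ℚ (d ℤ.* e)                   ≡⟨ cong ((x + y) *_) (ℤ→ℚ-* d e) ⟩
      (x + y) * (ℤ→ℚ d * ℤ→ℚ e)                 ≡⟨ distrib x y (ℤ→ℚ d) (ℤ→ℚ e) ⟩
      x * ℤ→ℚ d * ℤ→ℚ e + y * ℤ→ℚ e * ℤ→ℚ d    ≡⟨ cong₂ (λ s t → s * ℤ→ℚ e + t * ℤ→ℚ d) x-clears y-clears ⟩
      ℤ→ℚ m * ℤ→ℚ e + ℤ→ℚ n * ℤ→ℚ d            ≡⟨ sym (cong₂ _+_ (ℤ→ℚ-* m e) (ℤ→ℚ-* n d)) ⟩
      ℤ→ℚ (m ℤ.* e) + ℤ→ℚ (n ℤ.* d)            ≡⟨ sym (ℤ→ℚ-+ (m ℤ.* e) (n ℤ.* d)) ⟩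
      ℤ→ℚ (m ℤ.* e ℤ.+ n ℤ.* d)                ∎)
    where
    open ≡-Reasoning
    distrib : ∀ x y d e → (x + y) * (d * e) ≡ x * d * e + y * e * d
    distrib = Solver.solve-∀ ℚ-ring

  integral-* : ∀ {x y} → Integral x → Integral y → Integral (x * y)
  integral-* {x} {y} (integral m d d-unit x-clears) (integral n e e-unit y-clears) =
    integral (m ℤ.* n) (d ℤ.* e) (unit-* d-unit e-unit) (begin
      x * y * ℤ→ℚ (d ℤ.* e)         ≡⟨ cong (x * y *_) (ℤ→ℚ-* d e) ⟩
      x * y * (ℤ→ℚ d * ℤ→ℚ e)       ≡⟨ interchange x y (ℤ→ℚ d) (ℤ→ℚ e) ⟩
      x * ℤ→ℚ d * (y * ℤ→ℚ e)       ≡⟨ cong₂ _*_ x-clears y-clears ⟩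
      ℤ→ℚ m * ℤ→ℚ n                 ≡⟨ sym (ℤ→ℚ-* m n) ⟩
      ℤ→ℚ (m ℤ.* n)                 ∎)
    where
    open ≡-Reasoning
    interchange : ∀ x y d e → x * y * (d * e) ≡ x * d * (y * e)
    interchange = Solver.solve-∀ ℚ-ring

  integral-neg : ∀ {x} → Integral x → Integral (- x)
  integral-neg {x} x-integral =
    subst Integral (trans (cong (_* x) (ℤ→ℚ-neg (+ 1))) (-1*x≡-x x))
                   (integral-* (integral-ℤ (ℤ.- + 1)) x-integral)
    where
    -1*x≡-x : ∀ x → - 1ℚ * x ≡ - x
    -1*x≡-x = Solver.solve-∀ ℚ-ring

  integral-inv : ∀ {d} → Unit d → Integral (inv (ℤ→ℚ d))
  integral-inv {d} d-unit = integral (+ 1) d d-unit (*-invˡ (ℤ→ℚ d) (unit⇒≢0 d-unit))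

  infix 4 _≈_
  record _≈_ (x y : ℚ) : Set where
    constructor ≈-by
    field
      quotient          : ℚ
      quotient-integral : Integral quotient
      difference        : x ≡ y + P * quotient

  ≡⇒≈ : ∀ {x y} → x ≡ y → x ≈ y
  ≡⇒≈ {x} refl = ≈-by 0ℚ integral-0 (sym (trans (cong (_+_ x) (ℚP.*-zeroʳ P)) (ℚP.+-identityʳ x)))

  ≈-sym : ∀ {x y} → x ≈ y → y ≈ x
  ≈-sym {x} {y} (≈-by z z-integral x≡) =
    ≈-by (- z) (integral-neg z-integral) (trans (cancel y P z) (cong (λ t → t + P * - z) (sym x≡)))
    where
    cancel : ∀ y P z → y ≡ (y + P * z) + P * - z
    cancel = Solver.solve-∀ ℚ-ring

  ≈-trans : ∀ {x y w} → x ≈ y → y ≈ w → x ≈ w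
  ≈-trans {x} {y} {w} (≈-by z z-integral x≡) (≈-by z′ z′-integral y≡) =
    ≈-by (z′ + z) (integral-+ z′-integral z-integral)
         (trans x≡ (trans (cong (λ t → t + P * z) y≡) (collect w P z′ z)))
    where
    collect : ∀ w P z′ z → w + P * z′ + P * z ≡ w + P * (z′ + z)
    collect = Solver.solve-∀ ℚ-ring

  ≈-isEquivalence : IsEquivalence _≈_
  ≈-isEquivalence = record { refl = ≡⇒≈ refl ; sym = ≈-sym ; trans = ≈-trans }

  ≈-setoid : Setoid 0ℓ 0ℓ
  ≈-setoid = record { isEquivalence = ≈-isEquivalence }

  module ≈-Reasoning = SetoidReasoning ≈-setoid

  ≈-+ : ∀ {x y x′ y′} → x ≈ y → x′ ≈ y′ → x + x′ ≈ y + y′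
  ≈-+ {x} {y} {x′} {y′} (≈-by z z-integral x≡) (≈-by z′ z′-integral x′≡) =
    ≈-by (z + z′) (integral-+ z-integral z′-integral) (trans (cong₂ _+_ x≡ x′≡) (collect y y′ P z z′))
    where
    collect : ∀ y y′ P z z′ → (y + P * z) + (y′ + P * z′) ≡ (y + y′) + P * (z + z′)
    collect = Solver.solve-∀ ℚ-ring

  ≈-neg : ∀ {x y} → x ≈ y → - x ≈ - y
  ≈-neg {x} {y} (≈-by z z-integral x≡) =
    ≈-by (- z) (integral-neg z-integral) (trans (cong -_ x≡) (distrib y P z))
    where
    distrib : ∀ y P z → - (y + P * z) ≡ - y + P * - z
    distrib = Solver.solve-∀ ℚ-ring

  ≈-*ˡ : ∀ {c x y} → Integral c → x ≈ y → c * x ≈ c * y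
  ≈-*ˡ {c} {x} {y} c-integral (≈-by z z-integral x≡) =
    ≈-by (c * z) (integral-* c-integral z-integral) (trans (cong (c *_) x≡) (distrib c y P z))
    where
    distrib : ∀ c y P z → c * (y + P * z) ≡ c * y + P * (c * z)
    distrib = Solver.solve-∀ ℚ-ring

  ≈-integral : ∀ {x y} → x ≈ y → Integral y → Integral x
  ≈-integral (≈-by z z-integral x≡) y-integral =
    subst Integral (sym x≡) (integral-+ y-integral (integral-* (integral-ℤ (+ p)) z-integral))

  P*≈0 : ∀ {z} → Integral z → P * z ≈ 0ℚ
  P*≈0 {z} z-integral = ≈-by z z-integral (sym (ℚP.+-identityˡ (P * z)))

  ≈-cancel : ∀ {d x y} → Unit d → ℤ→ℚ d * x ≈ ℤ→ℚ d * y → x ≈ y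
  ≈-cancel {d} {x} {y} d-unit dx≈dy =
    subst₂ _≈_ (inv-*-cancelˡ (ℤ→ℚ d) x (unit⇒≢0 d-unit)) (inv-*-cancelˡ (ℤ→ℚ d) y (unit⇒≢0 d-unit))
               (≈-*ˡ (integral-inv d-unit) dx≈dy)

  integral⇒PIntegral : ∀ {x} → Integral x → PIntegral p x
  integral⇒PIntegral {x@(mkℚ n _ coprime)} (integral m d d-unit clears) p∣den =
    prime≢1 p-prime (Coprimality.recompute coprime (p∣n , p∣den))
    where
    p∣nd : p ℕD.∣ ℤ.∣ n ℤ.* d ∣
    p∣nd = subst (λ t → p ℕD.∣ ℤ.∣ t ∣) (sym (cross-multiply x d m clears))
             (subst (p ℕD.∣_) (sym (ℤP.abs-* m (↧ x))) (ℕD.∣-trans p∣den (ℕD.n∣m*n ℤ.∣ m ∣)))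
    p∣n : p ℕD.∣ ℤ.∣ n ∣
    p∣n = ∣unit-*⇒∣ n d-unit p∣nd

  ≈⇒CongMod : ∀ {x y} → Integral y → x ≈ y → CongMod p x y
  ≈⇒CongMod {x} {y} y-integral x≈y@(≈-by z (integral m d d-unit clears) x≡) =
    integral⇒PIntegral (≈-integral x≈y y-integral) , integral⇒PIntegral y-integral , p∣↥[x-y]
    where
    w = x - y
    w≡Pz : w ≡ P * z
    w≡Pz = trans (cong (_- y) x≡) (cancel y P z)
      where
      cancel : ∀ y P z → y + P * z - y ≡ P * z
      cancel = Solver.solve-∀ ℚ-ring
    w-clears : w * ℤ→ℚ d ≡ ℤ→ℚ (+ p ℤ.* m)
    w-clears = trans (cong (_* ℤ→ℚ d) w≡Pz)
      (trans (ℚP.*-assoc P z (ℤ→ℚ d)) (trans (cong (P *_) clears) (sym (ℤ→ℚ-* (+ p) m))))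
    p∣↥w*d : p ℕD.∣ ℤ.∣ ↥ w ℤ.* d ∣
    p∣↥w*d = subst (λ t → p ℕD.∣ ℤ.∣ t ∣) (sym (cross-multiply w d (+ p ℤ.* m) w-clears))
      (subst (p ℕD.∣_) (sym (trans (ℤP.abs-* (+ p ℤ.* m) (↧ w)) (cong (ℕ._* ℤ.∣ ↧ w ∣) (ℤP.abs-* (+ p) m))))
        (ℕD.∣-trans (ℕD.m∣m*n ℤ.∣ m ∣) (ℕD.m∣m*n ℤ.∣ ↧ w ∣)))
    p∣↥[x-y] : p ℕD.∣ ℤ.∣ ↥ w ∣
    p∣↥[x-y] = ∣unit-*⇒∣ (↥ w) d-unit p∣↥w*d

  Σ-integral : ∀ m (f : ℕ → ℚ) → (∀ k → k ℕ.< m → Integral (f (suc k))) → Integral (Σ[1… m ] f)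
  Σ-integral zero    f f-integral = integral-0
  Σ-integral (suc m) f f-integral =
    integral-+ (Σ-integral m f (λ k k<m → f-integral k (ℕP.m<n⇒m<1+n k<m))) (f-integral m ℕP.≤-refl)

  Σ-≈ : ∀ m (f g : ℕ → ℚ) → (∀ k → k ℕ.< m → f (suc k) ≈ g (suc k)) → Σ[1… m ] f ≈ Σ[1… m ] g
  Σ-≈ zero    f g f≈g = ≡⇒≈ refl
  Σ-≈ (suc m) f g f≈g = ≈-+ (Σ-≈ m f g (λ k k<m → f≈g k (ℕP.m<n⇒m<1+n k<m))) (f≈g m ℕP.≤-refl)

  congruent-via-unit : ∀ {d x y t} → Unit d → Integral t → ℤ→ℚ d * x ≈ t → ℤ→ℚ d * y ≈ t → CongMod p x y
  congruent-via-unit {d} {x} {y} d-unit t-integral dx≈t dy≈t =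
    ≈⇒CongMod y-integral (≈-cancel d-unit (≈-trans dx≈t (≈-sym dy≈t)))
    where
    y-integral : Integral y
    y-integral = subst Integral (inv-*-cancelˡ (ℤ→ℚ d) y (unit⇒≢0 d-unit))
                   (integral-* (integral-inv d-unit) (≈-integral dy≈t t-integral))

  integral-periodic₄ : ∀ (τ : ℕ → ℚ) → (∀ j → τ (4 ℕ.+ j) ≡ τ j) →
    Integral (τ 0) → Integral (τ 1) → Integral (τ 2) → Integral (τ 3) → ∀ j → Integral (τ j)
  integral-periodic₄ τ τ-periodic τ₀ τ₁ τ₂ τ₃ 0 = τ₀
  integral-periodic₄ τ τ-periodic τ₀ τ₁ τ₂ τ₃ 1 = τ₁
  integral-periodic₄ τ τ-periodic τ₀ τ₁ τ₂ τ₃ 2 = τ₂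
  integral-periodic₄ τ τ-periodic τ₀ τ₁ τ₂ τ₃ 3 = τ₃
  integral-periodic₄ τ τ-periodic τ₀ τ₁ τ₂ τ₃ (suc (suc (suc (suc j)))) =
    subst Integral (sym (τ-periodic j)) (integral-periodic₄ τ τ-periodic τ₀ τ₁ τ₂ τ₃ j)

  integral-re-i^ : ∀ j → Integral (re-i^ j)
  integral-re-i^ = integral-periodic₄ re-i^ (λ _ → refl) (integral-ℤ (+ 1)) integral-0 (integral-ℤ (ℤ.- + 1)) integral-0

  integral-im-i^ : ∀ j → Integral (im-i^ j)
  integral-im-i^ = integral-periodic₄ im-i^ (λ _ → refl) integral-0 (integral-ℤ (+ 1)) integral-0 (integral-ℤ (ℤ.- + 1))

  integral-δ₀ : ∀ j → Integral (δ₀ j)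
  integral-δ₀ = integral-periodic₄ δ₀ (λ _ → refl) (integral-ℤ (+ 4)) integral-0 integral-0 integral-0

  integral-δ₁ : ∀ j → Integral (δ₁ j)
  integral-δ₁ = integral-periodic₄ δ₁ (λ _ → refl) integral-0 (integral-ℤ (+ 4)) integral-0 integral-0

  integral-δ₃ : ∀ j → Integral (δ₃ j)
  integral-δ₃ = integral-periodic₄ δ₃ (λ _ → refl) integral-0 integral-0 integral-0 (integral-ℤ (+ 4))

module FermatQuotient (n : ℕ) (p-prime : Prime (suc n)) (p-odd : sign (suc n) ≡ - 1ℚ) where
  open Congruence (suc n) p-prime public

  P*invP : P * inv P ≡ 1ℚ
  P*invP = *-invʳ P (ℕ→ℚ-suc≢0 n)

  P*x*invP : ∀ x → P * x * inv P ≡ x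
  P*x*invP x = trans (ℚP.*-assoc P x (inv P)) (*-inv-cancelʳ P x (ℕ→ℚ-suc≢0 n))

  unit-suc : ∀ k → k ℕ.< n → Unit (+ suc k)
  unit-suc k k<n = unit λ p∣k+1 → ℕP.<-irrefl refl (ℕP.≤-trans (s≤s k<n) (ℕD.∣⇒≤ p∣k+1))

  c : ℕ → ℚ
  c j = chooseℚ (suc n) j * inv P

  P*c : ∀ j → P * c j ≡ chooseℚ (suc n) j
  P*c j = *-inv-cancelʳ P (chooseℚ (suc n) j) (ℕ→ℚ-suc≢0 n)

  c-suc : ∀ k → k ℕ.< n → c (suc k) ≡ inv (ℕ→ℚ (suc k)) * chooseℚ n k
  c-suc k k<n = begin
    c (suc k)                               ≡⟨ inv-*-cancelˡ K (c (suc k)) K≢0 ⟨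
    inv K * (K * c (suc k))                 ≡⟨ cong (inv K *_) (swap K (chooseℚ (suc n) (suc k)) (inv P)) ⟩
    inv K * (chooseℚ (suc n) (suc k) * K * inv P)
      ≡⟨ cong (λ t → inv K * (t * inv P)) (trans (sym (ℕ→ℚ-* (choose (suc n) (suc k)) (suc k)))
           (trans (cong ℕ→ℚ (choose-absorb n k)) (ℕ→ℚ-* (choose n k) (suc n)))) ⟩
    inv K * (chooseℚ n k * P * inv P)       ≡⟨ cong (inv K *_) (ℚP.*-assoc (chooseℚ n k) P (inv P)) ⟩
    inv K * (chooseℚ n k * (P * inv P))     ≡⟨ cong (λ t → inv K * (chooseℚ n k * t)) P*invP ⟩
    inv K * (chooseℚ n k * 1ℚ)              ≡⟨ cong (inv K *_) (ℚP.*-identityʳ (chooseℚ n k)) ⟩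
    inv K * chooseℚ n k                     ∎
    where
    open ≡-Reasoning
    K = ℕ→ℚ (suc k)
    K≢0 = unit⇒≢0 (unit-suc k k<n)
    swap : ∀ K b i → K * (b * i) ≡ b * K * i
    swap = Solver.solve-∀ ℚ-ring

  integral-c : ∀ k → k ℕ.< n → Integral (c (suc k))
  integral-c k k<n = subst Integral (sym (c-suc k k<n))
                       (integral-* (integral-inv (unit-suc k k<n)) (integral-ℤ (+ choose n k)))

  -- Pascal's rule turns p ≡ 0 into C(p - 1, k) ≡ (-1)ᵏ.
  choose≈sign : ∀ k → k ℕ.≤ n → chooseℚ n k ≈ sign k
  choose≈sign zero    _   = ≡⇒≈ refl
  choose≈sign (suc k) k<n = begin
    chooseℚ n (suc k)               ≡⟨ pascal ⟩
    P * c (suc k) + - chooseℚ n k   ≈⟨ ≈-+ (P*≈0 (integral-c k k<n)) (≈-neg (choose≈sign k (ℕP.<⇒≤ k<n))) ⟩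
    0ℚ + - sign k                   ≡⟨ trans (ℚP.+-identityˡ (- sign k)) (sym (sign-suc k)) ⟩
    sign (suc k)                    ∎
    where
    open ≈-Reasoning
    pascal : chooseℚ n (suc k) ≡ P * c (suc k) + - chooseℚ n k
    pascal = trans (rearrange (chooseℚ n (suc k)) (chooseℚ n k))
      (cong (_+ - chooseℚ n k) (trans (sym (ℕ→ℚ-+ (choose n k) (choose n (suc k)))) (sym (P*c (suc k)))))
      where
      rearrange : ∀ x y → x ≡ (y + x) + - y
      rearrange = Solver.solve-∀ ℚ-ring

  c≈ : ∀ k → k ℕ.< n → c (suc k) ≈ sign k * inv (ℕ→ℚ (suc k))
  c≈ k k<n = begin
    c (suc k)                       ≡⟨ c-suc k k<n ⟩
    inv (ℕ→ℚ (suc k)) * chooseℚ n k ≈⟨ ≈-*ˡ (integral-inv (unit-suc k k<n)) (choose≈sign k (ℕP.<⇒≤ k<n)) ⟩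
    inv (ℕ→ℚ (suc k)) * sign k      ≡⟨ ℚP.*-comm (inv (ℕ→ℚ (suc k))) (sign k) ⟩
    sign k * inv (ℕ→ℚ (suc k))      ∎
    where open ≈-Reasoning

  Σc : (ℕ → ℚ) → ℚ
  Σc w = Σ[1… n ] (λ j → c j * w j)

  Σc-cong : ∀ {w v : ℕ → ℚ} → (∀ j → w j ≡ v j) → Σc w ≡ Σc v
  Σc-cong e = Σ-cong n (λ k → cong (c (suc k) *_) (e (suc k)))

  Σc-+ : ∀ (w v : ℕ → ℚ) → Σc (λ j → w j + v j) ≡ Σc w + Σc v
  Σc-+ w v = trans (Σ-cong n (λ k → ℚP.*-distribˡ-+ (c (suc k)) (w (suc k)) (v (suc k))))
                   (Σ-distrib-+ n (λ j → c j * w j) (λ j → c j * v j))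

  Σc-*ˡ : ∀ x (w : ℕ → ℚ) → Σc (λ j → x * w j) ≡ x * Σc w
  Σc-*ˡ x w = trans (Σ-cong n (λ k → swap (c (suc k)) x (w (suc k)))) (Σ-distribˡ-* n x (λ j → c j * w j))
    where
    swap : ∀ c x w → c * (x * w) ≡ x * (c * w)
    swap = Solver.solve-∀ ℚ-ring

  Σc-integral : ∀ (w : ℕ → ℚ) → (∀ j → Integral (w j)) → Integral (Σc w)
  Σc-integral w w-integral = Σ-integral n (λ j → c j * w j) (λ k k<n → integral-* (integral-c k k<n) (w-integral (suc k)))

  Σc≈ : ∀ (w : ℕ → ℚ) → (∀ j → Integral (w j)) → Σc w ≈ Σ[1… n ] (λ j → sign (ℕ.pred j) * inv (ℕ→ℚ j) * w j)
  Σc≈ w w-integral = Σ-≈ n (λ j → c j * w j) _ (λ k k<n → begin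
    c (suc k) * w (suc k)                            ≡⟨ ℚP.*-comm (c (suc k)) (w (suc k)) ⟩
    w (suc k) * c (suc k)                            ≈⟨ ≈-*ˡ (w-integral (suc k)) (c≈ k k<n) ⟩
    w (suc k) * (sign k * inv (ℕ→ℚ (suc k)))         ≡⟨ ℚP.*-comm (w (suc k)) _ ⟩
    sign k * inv (ℕ→ℚ (suc k)) * w (suc k)           ∎)
    where open ≈-Reasoning

  binomialSum-p : ∀ (w : ℕ → ℚ) → binomialSum (suc n) w ≡ w 0 + P * Σc w + w (suc n)
  binomialSum-p w = begin
    w 0 + (Σ[1… n ] (λ j → chooseℚ (suc n) j * w j) + chooseℚ (suc n) (suc n) * w (suc n))
      ≡⟨ cong₂ (λ s t → w 0 + (s + ℕ→ℚ t * w (suc n))) factor-P (choose-diag (suc n)) ⟩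
    w 0 + (P * Σc w + 1ℚ * w (suc n)) ≡⟨ regroup (w 0) P (Σc w) (w (suc n)) ⟩
    w 0 + P * Σc w + w (suc n)        ∎
    where
    open ≡-Reasoning
    factor-P : Σ[1… n ] (λ j → chooseℚ (suc n) j * w j) ≡ P * Σc w
    factor-P = trans (Σ-cong n (λ k → trans (cong (_* w (suc k)) (sym (P*c (suc k))))
                                            (ℚP.*-assoc P (c (suc k)) (w (suc k)))))
                     (Σ-distribˡ-* n P (λ j → c j * w j))
    regroup : ∀ a P g b → a + (P * g + 1ℚ * b) ≡ a + P * g + b
    regroup = Solver.solve-∀ ℚ-ring

  integral-^ : ∀ {x} → Integral x → ∀ j → Integral (x ^ j)
  integral-^ x-integral zero    = integral-ℤ (+ 1)
  integral-^ x-integral (suc j) = integral-* x-integral (integral-^ x-integral j)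

  Φ : ℚ → ℚ
  Φ x = (x ^ suc n - x) * inv P

  ^p≡ : ∀ x → x ^ suc n ≡ x + P * Φ x
  ^p≡ x = begin
    x ^ suc n                     ≡⟨ split (x ^ suc n) x ⟩
    x + (x ^ suc n - x) * 1ℚ      ≡⟨ cong (λ t → x + (x ^ suc n - x) * t) (sym P*invP) ⟩
    x + (x ^ suc n - x) * (P * inv P) ≡⟨ swap x (x ^ suc n) P (inv P) ⟩
    x + P * Φ x                   ∎
    where
    open ≡-Reasoning
    split : ∀ y x → y ≡ x + (y - x) * 1ℚ
    split = Solver.solve-∀ ℚ-ring
    swap : ∀ x y P i → x + (y - x) * (P * i) ≡ x + P * ((y - x) * i)
    swap = Solver.solve-∀ ℚ-ring

  Φ-1+ : ∀ x → Φ (1ℚ + x) ≡ Φ x + Σc (x ^_)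
  Φ-1+ x = begin
    ((1ℚ + x) ^ suc n - (1ℚ + x)) * inv P
      ≡⟨ cong (λ t → (t - (1ℚ + x)) * inv P) (trans (binomial-theorem x (suc n)) (binomialSum-p (x ^_))) ⟩
    (1ℚ + P * Σc (x ^_) + x ^ suc n - (1ℚ + x)) * inv P
      ≡⟨ rearrange (Σc (x ^_)) (x ^ suc n) x P (inv P) ⟩
    Φ x + Σc (x ^_) * (P * inv P) ≡⟨ cong (λ t → Φ x + Σc (x ^_) * t) P*invP ⟩
    Φ x + Σc (x ^_) * 1ℚ          ≡⟨ cong (_+_ (Φ x)) (ℚP.*-identityʳ (Σc (x ^_))) ⟩
    Φ x + Σc (x ^_)               ∎
    where
    open ≡-Reasoning
    rearrange : ∀ g y x P i → (1ℚ + P * g + y - (1ℚ + x)) * i ≡ (y - x) * i + g * (P * i)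
    rearrange = Solver.solve-∀ ℚ-ring

  Φ-neg : ∀ x → Φ (- x) ≡ - Φ x
  Φ-neg x = begin
    ((- x) ^ suc n - - x) * inv P               ≡⟨ cong (λ t → (t - - x) * inv P) (neg-^ x (suc n)) ⟩
    (sign (suc n) * x ^ suc n - - x) * inv P    ≡⟨ cong (λ s → (s * x ^ suc n - - x) * inv P) p-odd ⟩
    (- 1ℚ * x ^ suc n - - x) * inv P            ≡⟨ distrib (x ^ suc n) x (inv P) ⟩
    - Φ x                                       ∎
    where
    open ≡-Reasoning
    distrib : ∀ y x i → (- 1ℚ * y - - x) * i ≡ - ((y - x) * i)
    distrib = Solver.solve-∀ ℚ-ring

  -- Fermat's little theorem, by induction through Φ (1 + k) = Φ k + Σc (k ^_).
  integral-Φ-ℕ : ∀ k → Integral (Φ (ℕ→ℚ k))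
  integral-Φ-ℕ zero    = subst Integral (sym Φ0≡0) integral-0
    where
    Φ0≡0 : Φ 0ℚ ≡ 0ℚ
    Φ0≡0 = trans (cong (λ t → (t - 0ℚ) * inv P) (ℚP.*-zeroˡ (0ℚ ^ n))) (ℚP.*-zeroˡ (inv P))
  integral-Φ-ℕ (suc k) = subst Integral (sym (trans (cong Φ (ℕ→ℚ-+ 1 k)) (Φ-1+ (ℕ→ℚ k))))
    (integral-+ (integral-Φ-ℕ k) (Σc-integral (ℕ→ℚ k ^_) (integral-^ (integral-ℤ (+ k)))))

  integral-Φ : ∀ a → Integral (Φ (ℤ→ℚ a))
  integral-Φ (+ k)      = integral-Φ-ℕ k
  integral-Φ -[1+ k ]   = subst Integral (sym (trans (cong Φ (ℤ→ℚ-neg (+ suc k))) (Φ-neg (ℕ→ℚ (suc k)))))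
                                (integral-neg (integral-Φ-ℕ (suc k)))

  qℚ : ℚ → ℚ
  qℚ x = (x ^ n - 1ℚ) * inv P

  x*qℚ≡Φ : ∀ x → x * qℚ x ≡ Φ x
  x*qℚ≡Φ x = distrib x (x ^ n) (inv P)
    where
    distrib : ∀ x y i → x * ((y - 1ℚ) * i) ≡ (x * y - x) * i
    distrib = Solver.solve-∀ ℚ-ring

  integral-qℚ : ∀ a → Unit a → Integral (qℚ (ℤ→ℚ a))
  integral-qℚ a a-unit = subst Integral (inv-*-cancelˡ (ℤ→ℚ a) (qℚ (ℤ→ℚ a)) (unit⇒≢0 a-unit))
    (integral-* (integral-inv a-unit) (subst Integral (sym (x*qℚ≡Φ (ℤ→ℚ a))) (integral-Φ a)))

  Φ≡ : ∀ x w → x ^ suc n ≡ x + P * w → Φ x ≡ w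
  Φ≡ x w x^p≡ = begin
    (x ^ suc n - x) * inv P       ≡⟨ cong (λ t → (t - x) * inv P) x^p≡ ⟩
    (x + P * w - x) * inv P       ≡⟨ cancel x P w (inv P) ⟩
    w * (P * inv P)               ≡⟨ cong (w *_) P*invP ⟩
    w * 1ℚ                        ≡⟨ ℚP.*-identityʳ w ⟩
    w                             ∎
    where
    open ≡-Reasoning
    cancel : ∀ x P w i → (x + P * w - x) * i ≡ w * (P * i)
    cancel = Solver.solve-∀ ℚ-ring

  q≡qℚ : ∀ x → q (suc n) x ≡ qℚ (ℤ→ℚ x)
  q≡qℚ x = trans (÷'≡*inv _ P)
    (cong (_* inv P) (trans (ℤ→ℚ-- (x ℤ.^ n) (+ 1)) (cong (_- 1ℚ) (ℤ→ℚ-^ x n))))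


-- The cases p ≡ 1 and p ≡ 3 (mod 4) differ only in ε = Im iᵖ = ±1.
module GaussianFermat (n : ℕ) (p-prime : Prime (suc n)) (p-odd : sign (suc n) ≡ - 1ℚ)
                      (ε : ℚ) (ε*ε≡1 : ε * ε ≡ 1ℚ)
                      (re-i^p : re-i^ (suc n) ≡ 0ℚ) (im-i^p : im-i^ (suc n) ≡ ε)
                      (a : ℤ) (p∤a : ¬ suc n ℕD.∣ ℤ.∣ a ∣) where
  open FermatQuotient n p-prime p-odd public

  A Q N : ℚ
  A = ℤ→ℚ a
  Q = qℚ A
  N = 1ℚ + A * A

  g h G₊ G₋ : ℚ
  g  = Σc (λ j → A ^ j * re-i^ j)
  h  = Σc (λ j → A ^ j * im-i^ j)
  G₊ = Σc (A ^_)
  G₋ = Σc ((- A) ^_)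

  two : ℚ
  two = 1ℚ + 1ℚ

  integral-A : Integral A
  integral-A = integral-ℤ a

  integral-Q : Integral Q
  integral-Q = integral-qℚ a (unit p∤a)

  integral-ε : Integral ε
  integral-ε = subst Integral im-i^p (integral-im-i^ (suc n))

  integral-g : Integral g
  integral-g = Σc-integral _ (λ j → integral-* (integral-^ integral-A j) (integral-re-i^ j))

  integral-h : Integral h
  integral-h = Σc-integral _ (λ j → integral-* (integral-^ integral-A j) (integral-im-i^ j))

  A^p≡ : A ^ suc n ≡ A + P * (A * Q)
  A^p≡ = trans (^p≡ A) (cong (λ t → A + P * t) (sym (x*qℚ≡Φ A)))

  gaussRe-p : gaussRe A (suc n) ≡ 1ℚ + P * g
  gaussRe-p = begin
    gaussRe A (suc n)                              ≡⟨ proj₁ (gauss-binomial A (suc n)) ⟩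
    binomialSum (suc n) (λ j → A ^ j * re-i^ j)    ≡⟨ binomialSum-p (λ j → A ^ j * re-i^ j) ⟩
    1ℚ * 1ℚ + P * g + A ^ suc n * re-i^ (suc n)    ≡⟨ cong (λ t → 1ℚ * 1ℚ + P * g + A ^ suc n * t) re-i^p ⟩
    1ℚ * 1ℚ + P * g + A ^ suc n * 0ℚ               ≡⟨ simplify P g (A ^ suc n) ⟩
    1ℚ + P * g                                     ∎
    where
    open ≡-Reasoning
    simplify : ∀ P g y → 1ℚ * 1ℚ + P * g + y * 0ℚ ≡ 1ℚ + P * g
    simplify = Solver.solve-∀ ℚ-ring

  gaussIm-p : gaussIm A (suc n) ≡ P * h + ε * (A + P * (A * Q))
  gaussIm-p = begin
    gaussIm A (suc n)                              ≡⟨ proj₂ (gauss-binomial A (suc n)) ⟩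
    binomialSum (suc n) (λ j → A ^ j * im-i^ j)    ≡⟨ binomialSum-p (λ j → A ^ j * im-i^ j) ⟩
    1ℚ * 0ℚ + P * h + A ^ suc n * im-i^ (suc n)    ≡⟨ cong₂ (λ s t → 1ℚ * 0ℚ + P * h + s * t) A^p≡ im-i^p ⟩
    1ℚ * 0ℚ + P * h + (A + P * (A * Q)) * ε        ≡⟨ simplify P h (A + P * (A * Q)) ε ⟩
    P * h + ε * (A + P * (A * Q))                  ∎
    where
    open ≡-Reasoning
    simplify : ∀ P h y e → 1ℚ * 0ℚ + P * h + y * e ≡ P * h + e * y
    simplify = Solver.solve-∀ ℚ-ring

  Φ-1+a : ℤ→ℚ (+ 1 ℤ.+ a) * qℚ (ℤ→ℚ (+ 1 ℤ.+ a)) ≡ A * Q + G₊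
  Φ-1+a = trans (x*qℚ≡Φ (ℤ→ℚ (+ 1 ℤ.+ a))) (trans (cong Φ (ℤ→ℚ-+ (+ 1) a)) (trans (Φ-1+ A) (cong (_+ G₊) (sym (x*qℚ≡Φ A)))))

  Φ-1-a : ℤ→ℚ (+ 1 ℤ.- a) * qℚ (ℤ→ℚ (+ 1 ℤ.- a)) ≡ - (A * Q) + G₋
  Φ-1-a = trans (x*qℚ≡Φ (ℤ→ℚ (+ 1 ℤ.- a))) (trans (cong Φ (ℤ→ℚ-- (+ 1) a))
            (trans (Φ-1+ (- A)) (cong (_+ G₋) (trans (Φ-neg A) (cong -_ (sym (x*qℚ≡Φ A)))))))

  K R : ℚ
  K = two * g + two * ε * A * h + two * (A * A) * Q
  R = g * g + h * h + two * ε * h * A * Q + A * A * Q * Q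

  integral-R : Integral R
  integral-R = integral-+ (integral-+ (integral-+ (integral-* integral-g integral-g) (integral-* integral-h integral-h))
                 (integral-* (integral-* (integral-* (integral-* (integral-ℤ (+ 2)) integral-ε) integral-h) integral-A)
                   integral-Q))
                 (integral-* (integral-* (integral-* integral-A integral-A) integral-Q) integral-Q)

  -- Nᵖ = |(1 + ai)ᵖ|², expanded with the real and imaginary parts of (1 + ai)ᵖ.
  N^p≡ : N ^ suc n ≡ N + P * (K + P * R)
  N^p≡ = begin
    N ^ suc n ≡⟨ sym (gauss-norm A (suc n)) ⟩
    gaussRe A (suc n) * gaussRe A (suc n) + gaussIm A (suc n) * gaussIm A (suc n)
      ≡⟨ cong₂ (λ s t → s * s + t * t) gaussRe-p gaussIm-p ⟩
    (1ℚ + P * g) * (1ℚ + P * g) + (P * h + ε * (A + P * (A * Q))) * (P * h + ε * (A + P * (A * Q)))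
      ≡⟨ expand P g h ε A Q ⟩
    1ℚ + ε * ε * (A * A) + P * (two * g + two * ε * A * h + two * (ε * ε) * (A * A) * Q
                                + P * (g * g + h * h + two * ε * h * A * Q + ε * ε * (A * A * Q * Q)))
      ≡⟨ cong (λ E → 1ℚ + E * (A * A) + P * (two * g + two * ε * A * h + two * E * (A * A) * Q
                                + P * (g * g + h * h + two * ε * h * A * Q + E * (A * A * Q * Q)))) ε*ε≡1 ⟩
    1ℚ + 1ℚ * (A * A) + P * (two * g + two * ε * A * h + two * 1ℚ * (A * A) * Q
                                + P * (g * g + h * h + two * ε * h * A * Q + 1ℚ * (A * A * Q * Q)))
      ≡⟨ simplify P g h ε A Q ⟩
    N + P * (K + P * R) ∎
    where
    open ≡-Reasoning
    expand : ∀ P g h ε A Q →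
      (1ℚ + P * g) * (1ℚ + P * g) + (P * h + ε * (A + P * (A * Q))) * (P * h + ε * (A + P * (A * Q)))
      ≡ 1ℚ + ε * ε * (A * A) + P * ((1ℚ + 1ℚ) * g + (1ℚ + 1ℚ) * ε * A * h + (1ℚ + 1ℚ) * (ε * ε) * (A * A) * Q
                                   + P * (g * g + h * h + (1ℚ + 1ℚ) * ε * h * A * Q + ε * ε * (A * A * Q * Q)))
    expand = Solver.solve-∀ ℚ-ring
    simplify : ∀ P g h ε A Q →
      1ℚ + 1ℚ * (A * A) + P * ((1ℚ + 1ℚ) * g + (1ℚ + 1ℚ) * ε * A * h + (1ℚ + 1ℚ) * 1ℚ * (A * A) * Q
                               + P * (g * g + h * h + (1ℚ + 1ℚ) * ε * h * A * Q + 1ℚ * (A * A * Q * Q)))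
      ≡ (1ℚ + A * A) + P * ((1ℚ + 1ℚ) * g + (1ℚ + 1ℚ) * ε * A * h + (1ℚ + 1ℚ) * (A * A) * Q
                             + P * (g * g + h * h + (1ℚ + 1ℚ) * ε * h * A * Q + A * A * Q * Q))
    simplify = Solver.solve-∀ ℚ-ring

  N*qN≈K : N * qℚ N ≈ K
  N*qN≈K = begin
    N * qℚ N  ≡⟨ trans (x*qℚ≡Φ N) (Φ≡ N (K + P * R) N^p≡) ⟩
    K + P * R ≈⟨ ≈-+ (≡⇒≈ {K} refl) (P*≈0 integral-R) ⟩
    K + 0ℚ    ≡⟨ ℚP.+-identityʳ K ⟩
    K         ∎
    where open ≈-Reasoning

  Λ : ℚ
  Λ = h + ε * A * (Q - g)

  gaussIm-p-sub : gaussIm A (suc n) - ε * A * gaussRe A (suc n) ≡ P * Λ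
  gaussIm-p-sub = trans (cong₂ (λ s t → s - ε * A * t) gaussIm-p gaussRe-p) (collect P h ε A Q g)
    where
    collect : ∀ P h ε A Q g → P * h + ε * (A + P * (A * Q)) - ε * A * (1ℚ + P * g) ≡ P * (h + ε * A * (Q - g))
    collect = Solver.solve-∀ ℚ-ring

  Σc-combination : ∀ x y (w τ : ℕ → ℚ) → (∀ j → 1ℚ + x * sign j + y * w j ≡ τ j) → (∀ j → Integral (τ j)) →
                   G₊ + x * G₋ + y * Σc (λ j → A ^ j * w j) ≈ Σ[1… n ] (logTerm A τ)
  Σc-combination x y w τ τ≡ τ-integral = begin
    G₊ + x * G₋ + y * Σc (λ j → A ^ j * w j)
      ≡⟨ cong₂ (λ s t → G₊ + s + t) (sym (Σc-*ˡ x ((- A) ^_))) (sym (Σc-*ˡ y (λ j → A ^ j * w j))) ⟩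
    G₊ + Σc (λ j → x * (- A) ^ j) + Σc (λ j → y * (A ^ j * w j))
      ≡⟨ cong (_+ Σc (λ j → y * (A ^ j * w j))) (sym (Σc-+ (A ^_) (λ j → x * (- A) ^ j))) ⟩
    Σc (λ j → A ^ j + x * (- A) ^ j) + Σc (λ j → y * (A ^ j * w j))
      ≡⟨ sym (Σc-+ (λ j → A ^ j + x * (- A) ^ j) (λ j → y * (A ^ j * w j))) ⟩
    Σc (λ j → A ^ j + x * (- A) ^ j + y * (A ^ j * w j))
      ≡⟨ Σc-cong (λ j → trans (cong (λ t → A ^ j + x * t + y * (A ^ j * w j)) (neg-^ A j))
                              (trans (factor (A ^ j) x (sign j) y (w j)) (cong (A ^ j *_) (τ≡ j)))) ⟩
    Σc (λ j → A ^ j * τ j)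
      ≈⟨ Σc≈ (λ j → A ^ j * τ j) (λ j → integral-* (integral-^ integral-A j) (τ-integral j)) ⟩
    Σ[1… n ] (logTerm A τ) ∎
    where
    open ≈-Reasoning
    factor : ∀ z x s y w → z + x * (s * z) + y * (z * w) ≡ z * (1ℚ + x * s + y * w)
    factor = Solver.solve-∀ ℚ-ring

  X₊ X₋ Ω : ℚ
  X₊ = A * Q + G₊
  X₋ = - (A * Q) + G₋
  Ω  = two * A * (ε * h + A * (Q - g))

  N*St≈Ω : ∀ S₀ → G₊ + 1ℚ * G₋ + two * g ≈ - S₀ → N * (S₀ + X₊ + X₋ + qℚ N) ≈ Ω
  N*St≈Ω S₀ c₀ = begin
    N * (S₀ + X₊ + X₋ + qℚ N)
      ≡⟨ split S₀ G₊ G₋ g h A Q ε (qℚ N) ⟩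
    N * (S₀ + (G₊ + 1ℚ * G₋ + two * g)) + (Ω - K) + N * qℚ N
      ≈⟨ ≈-+ (≈-+ (≈-*ˡ integral-N (≈-+ (≡⇒≈ {S₀} refl) c₀)) (≡⇒≈ {Ω - K} refl)) N*qN≈K ⟩
    N * (S₀ + - S₀) + (Ω - K) + K
      ≡⟨ cancel N S₀ Ω K ⟩
    Ω ∎
    where
    open ≈-Reasoning
    integral-N : Integral N
    integral-N = integral-+ (integral-ℤ (+ 1)) (integral-* integral-A integral-A)
    split : ∀ S₀ G₊ G₋ g h A Q ε q →
      (1ℚ + A * A) * (S₀ + (A * Q + G₊) + (- (A * Q) + G₋) + q)
      ≡ (1ℚ + A * A) * (S₀ + (G₊ + 1ℚ * G₋ + (1ℚ + 1ℚ) * g))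
        + ((1ℚ + 1ℚ) * A * (ε * h + A * (Q - g)) - ((1ℚ + 1ℚ) * g + (1ℚ + 1ℚ) * ε * A * h + (1ℚ + 1ℚ) * (A * A) * Q))
        + (1ℚ + A * A) * q
    split = Solver.solve-∀ ℚ-ring
    cancel : ∀ N S Ω K → N * (S + - S) + (Ω - K) + K ≡ Ω
    cancel = Solver.solve-∀ ℚ-ring

  AN*Y-A²NqN≈Ω : ∀ S → G₊ + - 1ℚ * G₋ + - (two * ε) * h ≈ ℕ→ℚ 4 * S →
                 A * N * (X₊ - X₋ - ℕ→ℚ 4 * S) - A * A * (N * qℚ N) ≈ Ω
  AN*Y-A²NqN≈Ω S c₂ = begin
    A * N * (X₊ - X₋ - ℕ→ℚ 4 * S) - A * A * (N * qℚ N)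
      ≡⟨ split S G₊ G₋ g h A Q ε (qℚ N) (ℕ→ℚ 4) ⟩
    Ω + A * N * ((G₊ + - 1ℚ * G₋ + - (two * ε) * h) - ℕ→ℚ 4 * S) + A * A * (K - N * qℚ N)
      ≈⟨ ≈-+ (≈-+ (≡⇒≈ {Ω} refl) (≈-*ˡ integral-AN (≈-+ c₂ (≡⇒≈ { - (ℕ→ℚ 4 * S)} refl))))
             (≈-*ˡ (integral-* integral-A integral-A) (≈-+ (≡⇒≈ {K} refl) (≈-neg N*qN≈K))) ⟩
    Ω + A * N * (ℕ→ℚ 4 * S - ℕ→ℚ 4 * S) + A * A * (K - K)
      ≡⟨ cancel Ω (A * N) (ℕ→ℚ 4 * S) (A * A) K ⟩
    Ω ∎
    where
    open ≈-Reasoning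
    integral-AN : Integral (A * N)
    integral-AN = integral-* integral-A (integral-+ (integral-ℤ (+ 1)) (integral-* integral-A integral-A))
    split : ∀ S G₊ G₋ g h A Q ε q F →
      A * (1ℚ + A * A) * ((A * Q + G₊) - (- (A * Q) + G₋) - F * S) - A * A * ((1ℚ + A * A) * q)
      ≡ (1ℚ + 1ℚ) * A * (ε * h + A * (Q - g))
        + A * (1ℚ + A * A) * ((G₊ + - 1ℚ * G₋ + - ((1ℚ + 1ℚ) * ε) * h) - F * S)
        + A * A * (((1ℚ + 1ℚ) * g + (1ℚ + 1ℚ) * ε * A * h + (1ℚ + 1ℚ) * (A * A) * Q) - (1ℚ + A * A) * q)
    split = Solver.solve-∀ ℚ-ring
    cancel : ∀ Ω B T C K → Ω + B * (T - T) + C * (K - K) ≡ Ω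
    cancel = Solver.solve-∀ ℚ-ring

  integral-Ω : Integral Ω
  integral-Ω = integral-* (integral-* (integral-ℤ (+ 2)) integral-A)
                 (integral-+ (integral-* integral-ε integral-h) (integral-* integral-A (integral-+ integral-Q (integral-neg integral-g))))

  two*A*Λ≡ε*Ω : two * A * Λ ≡ ε * Ω
  two*A*Λ≡ε*Ω = sym (begin
    ε * Ω                                      ≡⟨ expand ε A h Q g ⟩
    two * A * (ε * ε * h + ε * A * (Q - g))    ≡⟨ cong (λ E → two * A * (E * h + ε * A * (Q - g))) ε*ε≡1 ⟩
    two * A * (1ℚ * h + ε * A * (Q - g))       ≡⟨ cong (λ t → two * A * (t + ε * A * (Q - g))) (ℚP.*-identityˡ h) ⟩
    two * A * Λ                                ∎)
    where
    open ≡-Reasoning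
    expand : ∀ ε A h Q g → ε * ((1ℚ + 1ℚ) * A * (ε * h + A * (Q - g))) ≡ (1ℚ + 1ℚ) * A * (ε * ε * h + ε * A * (Q - g))
    expand = Solver.solve-∀ ℚ-ring

  X₊≡ : ℤ→ℚ (+ 1 ℤ.+ a) * q (suc n) (+ 1 ℤ.+ a) ≡ X₊
  X₊≡ = trans (cong (ℤ→ℚ (+ 1 ℤ.+ a) *_) (q≡qℚ (+ 1 ℤ.+ a))) Φ-1+a

  X₋≡ : ℤ→ℚ (+ 1 ℤ.- a) * q (suc n) (+ 1 ℤ.- a) ≡ X₋
  X₋≡ = trans (cong (ℤ→ℚ (+ 1 ℤ.- a) *_) (q≡qℚ (+ 1 ℤ.- a))) Φ-1-a

  qN≡ : q (suc n) (a ℤ.^ 2 ℤ.+ + 1) ≡ qℚ N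
  qN≡ = trans (q≡qℚ (a ℤ.^ 2 ℤ.+ + 1)) (cong qℚ (ℤ→ℚ-a²+1 a))

  unit-2a : ¬ suc n ℕD.∣ 2 → Unit (+ 2 ℤ.* a)
  unit-2a p∤2 = unit-* (unit {+ 2} p∤2) (unit {a} p∤a)

  unit-2a² : ¬ suc n ℕD.∣ 2 → Unit (+ 2 ℤ.* a ℤ.^ 2)
  unit-2a² p∤2 = unit-* (unit {+ 2} p∤2) (unit-* (unit {a} p∤a) (unit-* (unit {a} p∤a) unit-1))

  ℤ→ℚ-2a : ℤ→ℚ (+ 2 ℤ.* a) ≡ two * A
  ℤ→ℚ-2a = ℤ→ℚ-* (+ 2) a

  ℤ→ℚ-2a² : ℤ→ℚ (+ 2 ℤ.* a ℤ.^ 2) ≡ two * (A * A)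
  ℤ→ℚ-2a² = trans (ℤ→ℚ-* (+ 2) (a ℤ.^ 2)) (cong (two *_) (trans (ℤ→ℚ-^ a 2) (cong (A *_) (ℚP.*-identityʳ A))))

Q₊ Q₋ : ℤ → ℕ → ℚ
Q₊ a p = ℤ→ℚ (+ 1 ℤ.+ a) * q p (+ 1 ℤ.+ a)
Q₋ a p = ℤ→ℚ (+ 1 ℤ.- a) * q p (+ 1 ℤ.- a)

T₀ : ℤ → ℕ → ℚ
T₀ a m = Σ[1… m ] (λ k → ℤ→ℚ (a ℤ.^ (4 ℕ.* k)) ÷' ℕ→ℚ k)

T₋ : ℤ → ℕ → ℕ → ℚ
T₋ a r m = Σ[1… m ] (λ k → ℤ→ℚ (a ℤ.^ (4 ℕ.* k ∸ r)) ÷' ℕ→ℚ (4 ℕ.* k ∸ r))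

bracket : ℤ → ℕ → ℕ → ℚ
bracket a p m = T₀ a m + Q₊ a p + Q₋ a p + q p (a ℤ.^ 2 ℤ.+ + 1)

T₀≡ : ∀ a m → T₀ a m ≡ Σ[1… m ] (λ k → ℤ→ℚ a ^ (k ℕ.* 4) * inv (ℕ→ℚ k))
T₀≡ a m = Σ-cong m (λ k → trans (÷'≡*inv (ℤ→ℚ (a ℤ.^ (4 ℕ.* suc k))) (ℕ→ℚ (suc k)))
  (cong (_* inv (ℕ→ℚ (suc k))) (trans (ℤ→ℚ-^ a (4 ℕ.* suc k)) (cong (ℤ→ℚ a ^_) (ℕP.*-comm 4 (suc k))))))

T₋≡ : ∀ a r m → T₋ a r m ≡ Σ[1… m ] (λ k → powOver (ℤ→ℚ a) (k ℕ.* 4 ∸ r))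
T₋≡ a r m = Σ-cong m (λ k → trans (cong (λ j → ℤ→ℚ (a ℤ.^ j) ÷' ℕ→ℚ j) (cong (_∸ r) (ℕP.*-comm 4 (suc k))))
  (trans (÷'≡*inv (ℤ→ℚ (a ℤ.^ (suc k ℕ.* 4 ∸ r))) (ℕ→ℚ (suc k ℕ.* 4 ∸ r)))
         (cong (_* inv (ℕ→ℚ (suc k ℕ.* 4 ∸ r))) (ℤ→ℚ-^ a (suc k ℕ.* 4 ∸ r)))))

M₁ R₁ : ℤ → ℕ → ℚ
M₁ a p = bracket a p (ND._/_ (p ∸ 1) 4) ÷' ℤ→ℚ (+ 2 ℤ.* a ℤ.^ 2)
R₁ a p = (- (ℕ→ℚ 4 * T₋ a 1 (ND._/_ (p ∸ 1) 4)) + Q₊ a p - Q₋ a p) ÷' ℤ→ℚ (+ 2 ℤ.* a)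
         - q p (a ℤ.^ 2 ℤ.+ + 1) ÷' ℕ→ℚ 2

Congruences₁ : ℤ → ℕ → Set
Congruences₁ a p = (ℤ→ℚ (u a (p ∸ 1)) ÷' ℕ→ℚ p ≡ₚ M₁ a p [mod p ]) × (M₁ a p ≡ₚ R₁ a p [mod p ])

module Case₁ (m : ℕ) (p-prime : Prime (suc (m ℕ.* 4))) (a : ℤ) (p∤a : ¬ suc (m ℕ.* 4) ℕD.∣ ℤ.∣ a ∣)
             (p∤N : ¬ suc (m ℕ.* 4) ℕD.∣ ℤ.∣ a ℤ.^ 2 ℤ.+ + 1 ∣) (p∤2 : ¬ suc (m ℕ.* 4) ℕD.∣ 2) where
  open GaussianFermat (m ℕ.* 4) p-prime (sign-periodic 1 m) 1ℚ refl (re-i^-periodic 1 m) (im-i^-periodic 1 m) a p∤a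

  S₀ S₃ : ℚ
  S₀ = Σ[1… m ] (λ k → A ^ (k ℕ.* 4) * inv (ℕ→ℚ k))
  S₃ = Σ[1… m ] (λ k → powOver A (k ℕ.* 4 ∸ 1))

  c₀ : G₊ + 1ℚ * G₋ + two * g ≈ - S₀
  c₀ = ≈-trans (Σc-combination 1ℚ two re-i^ δ₀ δ₀-via-i^ integral-δ₀) (≡⇒≈ (Σ-logTerm-δ₀ A m))

  c₃ : G₊ + - 1ℚ * G₋ + - (two * 1ℚ) * h ≈ ℕ→ℚ 4 * S₃
  c₃ = ≈-trans (Σc-combination (- 1ℚ) (- (two * 1ℚ)) im-i^ δ₃ δ₃-via-i^ integral-δ₃) (≡⇒≈ (Σ-logTerm-δ₃ A m))

  m≡ : ND._/_ (m ℕ.* 4) 4 ≡ m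
  m≡ = ND.m*n/n≡m m 4

  d : ℤ
  d = (+ 2 ℤ.* a ℤ.^ 2) ℤ.* (a ℤ.^ 2 ℤ.+ + 1)

  unit-d : Unit d
  unit-d = unit-* (unit-2a² p∤2) (unit {a ℤ.^ 2 ℤ.+ + 1} p∤N)

  A*N*u≡P*Λ : A * N * ℤ→ℚ (u a (m ℕ.* 4)) ≡ P * Λ
  A*N*u≡P*Λ = begin
    A * N * ℤ→ℚ (u a (m ℕ.* 4))                ≡⟨ swap A N _ ⟩
    N * (A * ℤ→ℚ (u a (m ℕ.* 4)))              ≡⟨ cong (N *_) (proj₁ (a*u≡gaussIm a (m ℕ.* 4))) ⟩
    N * gaussIm A (m ℕ.* 4)                    ≡⟨ gaussIm-norm A (m ℕ.* 4) ⟩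
    gaussIm A p - A * gaussRe A p              ≡⟨ cong (λ t → gaussIm A p - t * gaussRe A p) (sym (ℚP.*-identityˡ A)) ⟩
    gaussIm A p - 1ℚ * A * gaussRe A p         ≡⟨ gaussIm-p-sub ⟩
    P * Λ                                      ∎
    where
    open ≡-Reasoning
    p = suc (m ℕ.* 4)
    swap : ∀ A N U → A * N * U ≡ N * (A * U)
    swap = Solver.solve-∀ ℚ-ring

  ℤ→ℚ-d : ℤ→ℚ d ≡ two * (A * A) * N
  ℤ→ℚ-d = trans (ℤ→ℚ-* (+ 2 ℤ.* a ℤ.^ 2) (a ℤ.^ 2 ℤ.+ + 1)) (cong₂ _*_ ℤ→ℚ-2a² (ℤ→ℚ-a²+1 a))

  d*L≡Ω : ℤ→ℚ d * (ℤ→ℚ (u a (m ℕ.* 4)) ÷' P) ≡ Ω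
  d*L≡Ω = begin
    ℤ→ℚ d * (U ÷' P)                  ≡⟨ cong₂ _*_ ℤ→ℚ-d (÷'≡*inv U P) ⟩
    two * (A * A) * N * (U * inv P)   ≡⟨ regroup two A N U (inv P) ⟩
    two * A * (A * N * U * inv P)     ≡⟨ cong (λ t → two * A * (t * inv P)) A*N*u≡P*Λ ⟩
    two * A * (P * Λ * inv P)         ≡⟨ cong (two * A *_) (P*x*invP Λ) ⟩
    two * A * Λ                       ≡⟨ two*A*Λ≡ε*Ω ⟩
    1ℚ * Ω                            ≡⟨ ℚP.*-identityˡ Ω ⟩
    Ω                                 ∎
    where
    open ≡-Reasoning
    U = ℤ→ℚ (u a (m ℕ.* 4))
    regroup : ∀ t A N U i → t * (A * A) * N * (U * i) ≡ t * A * (A * N * U * i)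
    regroup = Solver.solve-∀ ℚ-ring

  d*M≈Ω : ℤ→ℚ d * M₁ a (suc (m ℕ.* 4)) ≈ Ω
  d*M≈Ω = begin
    ℤ→ℚ d * M₁ a (suc (m ℕ.* 4))          ≡⟨ cong₂ _*_ (ℤ→ℚ-* (+ 2 ℤ.* a ℤ.^ 2) (a ℤ.^ 2 ℤ.+ + 1))
                                                   (trans (÷'≡*inv (bracket a (suc (m ℕ.* 4)) (ND._/_ (m ℕ.* 4) 4)) D₂) (cong (_* inv D₂) bracket≡)) ⟩
    D₂ * ℤ→ℚ (a ℤ.^ 2 ℤ.+ + 1) * (St * inv D₂) ≡⟨ swap D₂ (ℤ→ℚ (a ℤ.^ 2 ℤ.+ + 1)) (St * inv D₂) ⟩
    ℤ→ℚ (a ℤ.^ 2 ℤ.+ + 1) * (D₂ * (St * inv D₂))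
      ≡⟨ cong₂ _*_ (ℤ→ℚ-a²+1 a) (*-inv-cancelʳ D₂ St (unit⇒≢0 (unit-2a² p∤2))) ⟩
    N * St                                 ≈⟨ N*St≈Ω S₀ c₀ ⟩
    Ω                                      ∎
    where
    open ≈-Reasoning
    D₂ = ℤ→ℚ (+ 2 ℤ.* a ℤ.^ 2)
    St = S₀ + X₊ + X₋ + qℚ N
    bracket≡ : bracket a (suc (m ℕ.* 4)) (ND._/_ (m ℕ.* 4) 4) ≡ St
    bracket≡ = cong₂ _+_ (cong₂ _+_ (cong₂ _+_ (trans (cong (T₀ a) m≡) (T₀≡ a m)) X₊≡) X₋≡) qN≡
    swap : ∀ D M x → D * M * x ≡ M * (D * x)
    swap = Solver.solve-∀ ℚ-ring

  d*R≈Ω : ℤ→ℚ d * R₁ a (suc (m ℕ.* 4)) ≈ Ω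
  d*R≈Ω = begin
    ℤ→ℚ d * R₁ a (suc (m ℕ.* 4))
      ≡⟨ cong₂ _*_ ℤ→ℚ-d (cong₂ _-_ (trans (÷'≡*inv Yˢ D₁) (cong (_* inv D₁) Y≡))
                                    (trans (÷'≡*inv (q (suc (m ℕ.* 4)) (a ℤ.^ 2 ℤ.+ + 1)) (ℕ→ℚ 2))
                                           (cong (_* inv (ℕ→ℚ 2)) qN≡))) ⟩
    two * (A * A) * N * (Y * inv D₁ - qℚ N * inv (ℕ→ℚ 2))
      ≡⟨ regroup two A N Y (qℚ N) (inv D₁) (inv (ℕ→ℚ 2)) ⟩
    A * N * Y * (two * A * inv D₁) - A * A * (N * qℚ N) * (two * inv (ℕ→ℚ 2))
      ≡⟨ cong₂ (λ s t → A * N * Y * s - A * A * (N * qℚ N) * t)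
               (trans (cong (_* inv D₁) (sym ℤ→ℚ-2a)) (*-invʳ D₁ (unit⇒≢0 (unit-2a p∤2))))
               (*-invʳ (ℕ→ℚ 2) (ℕ→ℚ-suc≢0 1)) ⟩
    A * N * Y * 1ℚ - A * A * (N * qℚ N) * 1ℚ
      ≡⟨ reorder A N S₃ X₊ X₋ (N * qℚ N) (ℕ→ℚ 4) ⟩
    A * N * (X₊ - X₋ - ℕ→ℚ 4 * S₃) - A * A * (N * qℚ N)
      ≈⟨ AN*Y-A²NqN≈Ω S₃ c₃ ⟩
    Ω ∎
    where
    open ≈-Reasoning
    D₁ = ℤ→ℚ (+ 2 ℤ.* a)
    Y = - (ℕ→ℚ 4 * S₃) + X₊ - X₋
    Yˢ = - (ℕ→ℚ 4 * T₋ a 1 (ND._/_ (m ℕ.* 4) 4)) + Q₊ a (suc (m ℕ.* 4)) - Q₋ a (suc (m ℕ.* 4))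
    Y≡ : Yˢ ≡ Y
    Y≡ = cong₂ _-_ (cong₂ _+_ (cong (λ t → - (ℕ→ℚ 4 * t)) (trans (cong (T₋ a 1) m≡) (T₋≡ a 1 m))) X₊≡) X₋≡
    regroup : ∀ t A N Y q i j → t * (A * A) * N * (Y * i - q * j) ≡ A * N * Y * (t * A * i) - A * A * (N * q) * (t * j)
    regroup = Solver.solve-∀ ℚ-ring
    reorder : ∀ A N S X₊ X₋ r F → A * N * (- (F * S) + X₊ - X₋) * 1ℚ - A * A * r * 1ℚ ≡ A * N * (X₊ - X₋ - F * S) - A * A * r
    reorder = Solver.solve-∀ ℚ-ring

  result : Congruences₁ a (suc (m ℕ.* 4))
  result = congruent-via-unit unit-d integral-Ω (≡⇒≈ d*L≡Ω) d*M≈Ω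
         , congruent-via-unit unit-d integral-Ω d*M≈Ω d*R≈Ω

M₃ R₃ : ℤ → ℕ → ℚ
M₃ a p = - (ℤ→ℚ (a ℤ.^ 2 ℤ.+ + 1) ÷' ℤ→ℚ (+ 2 ℤ.* a ℤ.^ 2)) * bracket a p (ND._/_ (p ∸ 3) 4)
R₃ a p = (ℤ→ℚ (a ℤ.^ 2 ℤ.+ + 1) ÷' ℤ→ℚ (+ 2 ℤ.* a)) * (ℕ→ℚ 4 * T₋ a 3 (ND._/_ (p ℕ.+ 1) 4) - Q₊ a p + Q₋ a p)
         + (ℤ→ℚ (a ℤ.^ 2 ℤ.+ + 1) ÷' ℕ→ℚ 2) * q p (a ℤ.^ 2 ℤ.+ + 1)

Congruences₃ : ℤ → ℕ → Set
Congruences₃ a p = (ℤ→ℚ (u a (p ℕ.+ 1)) ÷' ℕ→ℚ p ≡ₚ M₃ a p [mod p ]) × (M₃ a p ≡ₚ R₃ a p [mod p ])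

module Case₃ (m : ℕ) (p-prime : Prime (3 ℕ.+ m ℕ.* 4)) (a : ℤ) (p∤a : ¬ 3 ℕ.+ m ℕ.* 4 ℕD.∣ ℤ.∣ a ∣)
             (p∤2 : ¬ 3 ℕ.+ m ℕ.* 4 ℕD.∣ 2) where
  open GaussianFermat (2 ℕ.+ m ℕ.* 4) p-prime (sign-periodic 3 m) (- 1ℚ) refl (re-i^-periodic 3 m) (im-i^-periodic 3 m) a p∤a

  p : ℕ
  p = 3 ℕ.+ m ℕ.* 4

  S₀ S₁ : ℚ
  S₀ = Σ[1… m ] (λ k → A ^ (k ℕ.* 4) * inv (ℕ→ℚ k))
  S₁ = Σ[1… suc m ] (λ k → powOver A (k ℕ.* 4 ∸ 3))

  c₀ : G₊ + 1ℚ * G₋ + two * g ≈ - S₀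
  c₀ = ≈-trans (Σc-combination 1ℚ two re-i^ δ₀ δ₀-via-i^ integral-δ₀) (≡⇒≈ (Σ-logTerm-δ₀-+2 A m))

  c₁ : G₊ + - 1ℚ * G₋ + - (two * - 1ℚ) * h ≈ ℕ→ℚ 4 * S₁
  c₁ = ≈-trans (Σc-combination (- 1ℚ) (- (two * - 1ℚ)) im-i^ δ₁ δ₁-via-i^ integral-δ₁) (≡⇒≈ (Σ-logTerm-δ₁-+2 A m))

  D₂ : ℚ
  D₂ = ℤ→ℚ (+ 2 ℤ.* a ℤ.^ 2)

  A*u≡P*Λ : A * ℤ→ℚ (u a (p ℕ.+ 1)) ≡ P * Λ
  A*u≡P*Λ = begin
    A * ℤ→ℚ (u a (p ℕ.+ 1))                   ≡⟨ cong (λ j → A * ℤ→ℚ (u a j)) (ℕP.+-comm p 1) ⟩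
    A * ℤ→ℚ (u a (suc p))                     ≡⟨ proj₂ (a*u≡gaussIm a p) ⟩
    gaussIm A p + A * gaussRe A p             ≡⟨ sign-flip (gaussIm A p) A (gaussRe A p) ⟩
    gaussIm A p - - 1ℚ * A * gaussRe A p      ≡⟨ gaussIm-p-sub ⟩
    P * Λ                                     ∎
    where
    open ≡-Reasoning
    sign-flip : ∀ s A r → s + A * r ≡ s - - 1ℚ * A * r
    sign-flip = Solver.solve-∀ ℚ-ring

  d*L≡-Ω : D₂ * (ℤ→ℚ (u a (p ℕ.+ 1)) ÷' P) ≡ - Ω
  d*L≡-Ω = begin
    D₂ * (U ÷' P)                  ≡⟨ cong₂ _*_ ℤ→ℚ-2a² (÷'≡*inv U P) ⟩
    two * (A * A) * (U * inv P)    ≡⟨ regroup two A U (inv P) ⟩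
    two * A * (A * U * inv P)      ≡⟨ cong (λ t → two * A * (t * inv P)) A*u≡P*Λ ⟩
    two * A * (P * Λ * inv P)      ≡⟨ cong (two * A *_) (P*x*invP Λ) ⟩
    two * A * Λ                    ≡⟨ two*A*Λ≡ε*Ω ⟩
    - 1ℚ * Ω                       ≡⟨ -1*x≡-x Ω ⟩
    - Ω                            ∎
    where
    open ≡-Reasoning
    U = ℤ→ℚ (u a (p ℕ.+ 1))
    regroup : ∀ t A U i → t * (A * A) * (U * i) ≡ t * A * (A * U * i)
    regroup = Solver.solve-∀ ℚ-ring
    -1*x≡-x : ∀ x → - 1ℚ * x ≡ - x
    -1*x≡-x = Solver.solve-∀ ℚ-ring

  d*M≈-Ω : D₂ * M₃ a p ≈ - Ω
  d*M≈-Ω = begin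
    D₂ * M₃ a p                                      ≡⟨ cong (λ t → D₂ * (- t * bracket a p (ND._/_ (m ℕ.* 4) 4)))
                                                             (÷'≡*inv (ℤ→ℚ (a ℤ.^ 2 ℤ.+ + 1)) D₂) ⟩
    D₂ * (- (ℤ→ℚ (a ℤ.^ 2 ℤ.+ + 1) * inv D₂) * bracket a p (ND._/_ (m ℕ.* 4) 4))
      ≡⟨ cong₂ (λ s t → D₂ * (- (s * inv D₂) * t)) (ℤ→ℚ-a²+1 a) bracket≡ ⟩
    D₂ * (- (N * inv D₂) * St)                       ≡⟨ regroup D₂ N (inv D₂) St ⟩
    - (N * St * (D₂ * inv D₂))                       ≡⟨ cong (λ t → - (N * St * t)) (*-invʳ D₂ (unit⇒≢0 (unit-2a² p∤2))) ⟩
    - (N * St * 1ℚ)                                  ≡⟨ cong -_ (ℚP.*-identityʳ (N * St)) ⟩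
    - (N * St)                                       ≈⟨ ≈-neg (N*St≈Ω S₀ c₀) ⟩
    - Ω                                              ∎
    where
    open ≈-Reasoning
    St = S₀ + X₊ + X₋ + qℚ N
    bracket≡ : bracket a p (ND._/_ (m ℕ.* 4) 4) ≡ St
    bracket≡ = cong₂ _+_ (cong₂ _+_ (cong₂ _+_ (trans (cong (T₀ a) (ND.m*n/n≡m m 4)) (T₀≡ a m)) X₊≡) X₋≡) qN≡
    regroup : ∀ D N i S → D * (- (N * i) * S) ≡ - (N * S * (D * i))
    regroup = Solver.solve-∀ ℚ-ring

  d*R≈-Ω : D₂ * R₃ a p ≈ - Ω
  d*R≈-Ω = begin
    D₂ * R₃ a p
      ≡⟨ cong₂ _*_ ℤ→ℚ-2a² (cong₂ _+_
           (cong₂ _*_ (trans (÷'≡*inv (ℤ→ℚ (a ℤ.^ 2 ℤ.+ + 1)) D₁) (cong (_* inv D₁) (ℤ→ℚ-a²+1 a))) W≡)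
           (cong₂ _*_ (trans (÷'≡*inv (ℤ→ℚ (a ℤ.^ 2 ℤ.+ + 1)) (ℕ→ℚ 2)) (cong (_* inv (ℕ→ℚ 2)) (ℤ→ℚ-a²+1 a))) qN≡)) ⟩
    two * (A * A) * (N * inv D₁ * W + N * inv (ℕ→ℚ 2) * qℚ N)
      ≡⟨ regroup two A N W (qℚ N) (inv D₁) (inv (ℕ→ℚ 2)) ⟩
    A * N * W * (two * A * inv D₁) + A * A * (N * qℚ N) * (two * inv (ℕ→ℚ 2))
      ≡⟨ cong₂ (λ s t → A * N * W * s + A * A * (N * qℚ N) * t)
               (trans (cong (_* inv D₁) (sym ℤ→ℚ-2a)) (*-invʳ D₁ (unit⇒≢0 (unit-2a p∤2))))
               (*-invʳ (ℕ→ℚ 2) (ℕ→ℚ-suc≢0 1)) ⟩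
    A * N * W * 1ℚ + A * A * (N * qℚ N) * 1ℚ
      ≡⟨ reorder A N S₁ X₊ X₋ (N * qℚ N) (ℕ→ℚ 4) ⟩
    - (A * N * (X₊ - X₋ - ℕ→ℚ 4 * S₁) - A * A * (N * qℚ N))
      ≈⟨ ≈-neg (AN*Y-A²NqN≈Ω S₁ c₁) ⟩
    - Ω ∎
    where
    open ≈-Reasoning
    D₁ = ℤ→ℚ (+ 2 ℤ.* a)
    W = ℕ→ℚ 4 * S₁ - X₊ + X₋
    W≡ : ℕ→ℚ 4 * T₋ a 3 (ND._/_ (p ℕ.+ 1) 4) - Q₊ a p + Q₋ a p ≡ W
    W≡ = cong₂ _+_ (cong₂ _-_ (cong (ℕ→ℚ 4 *_) (trans (cong (λ j → T₋ a 3 (ND._/_ j 4)) (ℕP.+-comm p 1))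
                                                 (trans (cong (T₋ a 3) (ND.m*n/n≡m (suc m) 4)) (T₋≡ a 3 (suc m)))))
                              X₊≡) X₋≡
    regroup : ∀ t A N W q i j → t * (A * A) * (N * i * W + N * j * q) ≡ A * N * W * (t * A * i) + A * A * (N * q) * (t * j)
    regroup = Solver.solve-∀ ℚ-ring
    reorder : ∀ A N S X₊ X₋ r F → A * N * (F * S - X₊ + X₋) * 1ℚ + A * A * r * 1ℚ ≡ - (A * N * (X₊ - X₋ - F * S) - A * A * r)
    reorder = Solver.solve-∀ ℚ-ring

  result : Congruences₃ a p
  result = congruent-via-unit (unit-2a² p∤2) (integral-neg integral-Ω) (≡⇒≈ d*L≡-Ω) d*M≈-Ω
         , congruent-via-unit (unit-2a² p∤2) (integral-neg integral-Ω) d*M≈-Ω d*R≈-Ω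

congruences₁ : ∀ {p} m → p ≡ suc (m ℕ.* 4) → Prime p → ∀ a → ¬ p ℕD.∣ ℤ.∣ a ∣ →
               ¬ p ℕD.∣ ℤ.∣ a ℤ.^ 2 ℤ.+ + 1 ∣ → ¬ p ℕD.∣ 2 → Congruences₁ a p
congruences₁ m refl p-prime a p∤a p∤N p∤2 = Case₁.result m p-prime a p∤a p∤N p∤2

congruences₃ : ∀ {p} m → p ≡ 3 ℕ.+ m ℕ.* 4 → Prime p → ∀ a → ¬ p ℕD.∣ ℤ.∣ a ∣ →
               ¬ p ℕD.∣ 2 → Congruences₃ a p
congruences₃ m refl p-prime a p∤a p∤2 = Case₃.result m p-prime a p∤a p∤2

≡r+[/4]*4 : ∀ p r → ND._%_ p 4 ≡ r → p ≡ r ℕ.+ ND._/_ p 4 ℕ.* 4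
≡r+[/4]*4 p r p%4≡r = trans (ND.m≡m%n+[m/n]*n p 4) (cong (ℕ._+ ND._/_ p 4 ℕ.* 4) p%4≡r)

odd-prime∤2 : ∀ {p} → Prime p → ¬ p ≡ 2 → ¬ p ℕD.∣ 2
odd-prime∤2 {p} p-prime p≢2 p∣2 =
  p≢2 (ℕP.≤-antisym (ℕD.∣⇒≤ p∣2) (ℕ.nonTrivial⇒n>1 p {{prime⇒nonTrivial p-prime}}))

a[a⁴-1]≡ : ∀ a → a ℤ.* (a ℤ.^ 4 ℤ.- + 1) ≡ a ℤ.* ((a ℤ.^ 2 ℤ.+ + 1) ℤ.* (a ℤ.* a ℤ.- + 1))
a[a⁴-1]≡ a = unfolded a
  where
  unfolded : ∀ a → a ℤ.* (a ℤ.* (a ℤ.* (a ℤ.* (a ℤ.* + 1))) ℤ.- + 1)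
                   ≡ a ℤ.* ((a ℤ.* (a ℤ.* + 1) ℤ.+ + 1) ℤ.* (a ℤ.* a ℤ.- + 1))
  unfolded = ℤ-Solver.solve-∀

∤a[a⁴-1]⇒∤a : ∀ {p} a → ¬ (+ p) ℤD.∣ (a ℤ.* (a ℤ.^ 4 ℤ.- + 1)) → ¬ p ℕD.∣ ℤ.∣ a ∣
∤a[a⁴-1]⇒∤a {p} a p∤ p∣a =
  p∤ (subst (p ℕD.∣_) (sym (ℤP.abs-* a (a ℤ.^ 4 ℤ.- + 1))) (ℕD.∣-trans p∣a (ℕD.m∣m*n _)))

∤a[a⁴-1]⇒∤a²+1 : ∀ {p} a → ¬ (+ p) ℤD.∣ (a ℤ.* (a ℤ.^ 4 ℤ.- + 1)) → ¬ p ℕD.∣ ℤ.∣ a ℤ.^ 2 ℤ.+ + 1 ∣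
∤a[a⁴-1]⇒∤a²+1 {p} a p∤ p∣N = p∤ (subst (λ t → p ℕD.∣ ℤ.∣ t ∣) (sym (a[a⁴-1]≡ a))
  (subst (p ℕD.∣_) (sym (trans (ℤP.abs-* a _) (cong (ℤ.∣ a ∣ ℕ.*_) (ℤP.abs-* (a ℤ.^ 2 ℤ.+ + 1) _))))
    (ℕD.∣-trans p∣N (ℕD.∣-trans (ℕD.m∣m*n _) (ℕD.n∣m*n ℤ.∣ a ∣)))))

theorem5p4 : (a : ℤ) (p : ℕ) → Prime p → ¬ (p ≡ 2)
  → ¬ ((+ p) ℤD.∣ (a ℤ.* (a ℤ.^ 4 ℤ.- + 1)))
  → (ND._%_ p 4 ≡ 1
      → (ℤ→ℚ (u a (p ∸ 1)) ÷' ℕ→ℚ p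
           ≡ₚ (Σ[1… ND._/_ (p ∸ 1) 4 ] (λ k → ℤ→ℚ (a ℤ.^ (4 ℕ.* k)) ÷' ℕ→ℚ k)
               + ℤ→ℚ (+ 1 ℤ.+ a) * q p (+ 1 ℤ.+ a)
               + ℤ→ℚ (+ 1 ℤ.- a) * q p (+ 1 ℤ.- a)
               + q p (a ℤ.^ 2 ℤ.+ + 1)) ÷' ℤ→ℚ (+ 2 ℤ.* a ℤ.^ 2) [mod p ])
       × ((Σ[1… ND._/_ (p ∸ 1) 4 ] (λ k → ℤ→ℚ (a ℤ.^ (4 ℕ.* k)) ÷' ℕ→ℚ k)
               + ℤ→ℚ (+ 1 ℤ.+ a) * q p (+ 1 ℤ.+ a)
               + ℤ→ℚ (+ 1 ℤ.- a) * q p (+ 1 ℤ.- a)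
               + q p (a ℤ.^ 2 ℤ.+ + 1)) ÷' ℤ→ℚ (+ 2 ℤ.* a ℤ.^ 2)
           ≡ₚ (- (ℕ→ℚ 4 * Σ[1… ND._/_ (p ∸ 1) 4 ]
                    (λ k → ℤ→ℚ (a ℤ.^ (4 ℕ.* k ∸ 1)) ÷' ℕ→ℚ (4 ℕ.* k ∸ 1)))
               + ℤ→ℚ (+ 1 ℤ.+ a) * q p (+ 1 ℤ.+ a)
               - ℤ→ℚ (+ 1 ℤ.- a) * q p (+ 1 ℤ.- a)) ÷' ℤ→ℚ (+ 2 ℤ.* a)
             - q p (a ℤ.^ 2 ℤ.+ + 1) ÷' ℕ→ℚ 2 [mod p ]))
  × (ND._%_ p 4 ≡ 3
      → (ℤ→ℚ (u a (p ℕ.+ 1)) ÷' ℕ→ℚ p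
           ≡ₚ - (ℤ→ℚ (a ℤ.^ 2 ℤ.+ + 1) ÷' ℤ→ℚ (+ 2 ℤ.* a ℤ.^ 2))
             * (Σ[1… ND._/_ (p ∸ 3) 4 ] (λ k → ℤ→ℚ (a ℤ.^ (4 ℕ.* k)) ÷' ℕ→ℚ k)
               + ℤ→ℚ (+ 1 ℤ.+ a) * q p (+ 1 ℤ.+ a)
               + ℤ→ℚ (+ 1 ℤ.- a) * q p (+ 1 ℤ.- a)
               + q p (a ℤ.^ 2 ℤ.+ + 1)) [mod p ])
       × (- (ℤ→ℚ (a ℤ.^ 2 ℤ.+ + 1) ÷' ℤ→ℚ (+ 2 ℤ.* a ℤ.^ 2))
             * (Σ[1… ND._/_ (p ∸ 3) 4 ] (λ k → ℤ→ℚ (a ℤ.^ (4 ℕ.* k)) ÷' ℕ→ℚ k)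
               + ℤ→ℚ (+ 1 ℤ.+ a) * q p (+ 1 ℤ.+ a)
               + ℤ→ℚ (+ 1 ℤ.- a) * q p (+ 1 ℤ.- a)
               + q p (a ℤ.^ 2 ℤ.+ + 1))
           ≡ₚ (ℤ→ℚ (a ℤ.^ 2 ℤ.+ + 1) ÷' ℤ→ℚ (+ 2 ℤ.* a))
             * (ℕ→ℚ 4 * Σ[1… ND._/_ (p ℕ.+ 1) 4 ]
                    (λ k → ℤ→ℚ (a ℤ.^ (4 ℕ.* k ∸ 3)) ÷' ℕ→ℚ (4 ℕ.* k ∸ 3))
               - ℤ→ℚ (+ 1 ℤ.+ a) * q p (+ 1 ℤ.+ a)
               + ℤ→ℚ (+ 1 ℤ.- a) * q p (+ 1 ℤ.- a))
             + (ℤ→ℚ (a ℤ.^ 2 ℤ.+ + 1) ÷' ℕ→ℚ 2) * q p (a ℤ.^ 2 ℤ.+ + 1) [mod p ]))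
theorem5p4 a p p-prime p≢2 p∤a[a⁴-1] =
    (λ p%4≡1 → congruences₁ (ND._/_ p 4) (≡r+[/4]*4 p 1 p%4≡1) p-prime a p∤a p∤a²+1 p∤2)
  , (λ p%4≡3 → congruences₃ (ND._/_ p 4) (≡r+[/4]*4 p 3 p%4≡3) p-prime a p∤a p∤2)
  where
  p∤a = ∤a[a⁴-1]⇒∤a a p∤a[a⁴-1]
  p∤a²+1 = ∤a[a⁴-1]⇒∤a²+1 a p∤a[a⁴-1]
  p∤2 = odd-prime∤2 p-prime p≢2
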